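{- Let $1 \le k \le n$ be integers and $X = |A/A|$, where $A/A=\{a/a' : a,a'\in A\}$. Let $\mathbb{E}_k$ denote expectation when $A$ is chosen uniformly at random among all $k$-element subsets of $\{1,\dots,n\}$, and $\mathbb{E}$ expectation when each $m\in\{1,\dots,n\}$ belongs to $A$ independently with probability $k/n$. Then for $s\in\{1,2\}$, $$\mathbb{E}_k(X^s) = \mathbb{E}(X^s) + O\!\left(k^{2s-1/2}\right).$$ -}

module Defs where

open import Data.Nat as ℕ using (ℕ; zero; suc)
open import Data.Integer using (+_)
open import Data.List using (List; []; _∷_; map; _++_; concatMap; length; filter; deduplicate; upTo; foldr)
open import Data.Nat.ListAction using (sum)
open import Data.Rational using (ℚ; _/_; 0ℚ; 1ℚ; _+_; _*_; _-_)
open import Data.Rational.Properties using (_≟_)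
open import Relation.Nullary.Decidable using (⌊_⌋)

range : ℕ → List ℕ
range n = map suc (upTo n)

subsets : {A : Set} → List A → List (List A)
subsets [] = [] ∷ []
subsets (x ∷ xs) = map (x ∷_) (subsets xs) ++ subsets xs

kSubsets : ℕ → ℕ → List (List ℕ)
kSubsets n k = filter (λ A → length A ℕ.≟ k) (subsets (range n))

-- the rational a/a' (a' = 0 never occurs for A ⊆ {1,…,n})
ratio : ℕ → ℕ → ℚ
ratio a zero = 0ℚ
ratio a (suc b) = (+ a) / suc b

ratioSet : List ℕ → List ℚ
ratioSet A = deduplicate _≟_ (concatMap (λ a → map (ratio a) A) A)

X : List ℕ → ℕ
X A = length (ratioSet A)

_^ℚ_ : ℚ → ℕ → ℚ
p ^ℚ zero = 1ℚ
p ^ℚ suc m = p * (p ^ℚ m)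

ℕtoℚ : ℕ → ℚ
ℕtoℚ m = (+ m) / 1

sumℚ : List ℚ → ℚ
sumℚ = foldr _+_ 0ℚ

mean : List ℕ → ℚ
mean [] = 0ℚ
mean (x ∷ xs) = (+ (x ℕ.+ sum xs)) / suc (length xs)

Ek : ℕ → ℕ → (List ℕ → ℕ) → ℚ
Ek n k f = mean (map f (kSubsets n k))

-- 𝔼(f(A)) : each m ∈ {1,…,n} in A independently with probability k/n
-- (n = 0 is never used; value 0 there)
Ebin : ℕ → ℕ → (List ℕ → ℕ) → ℚ
Ebin zero k f = 0ℚ
Ebin (suc n') k f =
  sumℚ (map (λ A → (p ^ℚ length A) * ((1ℚ - p) ^ℚ (suc n' ℕ.∸ length A)) * ℕtoℚ (f A))
            (subsets (range (suc n'))))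
  where
  p : ℚ
  p = (+ k) / suc n'

module Submission where

-- Let F(j) be the mean of f(A) = |A/A|^s over the j-subsets A of {1,…,n}. Grouping the
-- binomial model by |A| gives 𝔼 f = 𝔼 F(J) with J ~ Binomial(n, k/n). Adding one
-- element to A never shrinks A/A and adds at most 2|A| ratios, so double counting the
-- pairs (A ∖ {x}, A) shows 0 ≤ F(j+1) - F(j) ≤ c (j+1)^e, with (c, e) = (2, 1) for s = 1
-- and (8, 3) for s = 2. Hence |F(k) - 𝔼 F(J)| ≤ c 𝔼(|J - k| (J + k)^e), and by
-- Cauchy–Schwarz with 𝔼 (J - k)² ≤ k and 𝔼 (J + k)^(2e) ≤ ((2 + 2e) k)^(2e) the squared
-- gap times k is O(k^(2e+2)) = O(k^(4s)).

open import Algebra.Bundles using (CommutativeSemiring)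

module RationalArithmetic where
  open import Data.Nat as ℕ using (ℕ; zero; suc)
  import Data.Nat.Properties as ℕₚ
  open import Data.Integer as ℤ using (+_)
  import Data.Integer.Properties as ℤₚ
  import Data.Nat.Coprimality as Coprimality
  open import Data.Rational hiding (∣_∣)
  open import Data.Rational.Properties
  import Data.Rational.Unnormalised as ℚᵘ
  import Data.Rational.Unnormalised.Properties as ℚᵘ
  open import Data.List using ([]; _∷_)
  open import Data.Sum using (inj₁; inj₂)
  open import Level using (0ℓ)
  open import Relation.Binary.PropositionalEquality
  open import Relation.Nullary.Decidable using (dec⇒maybe)
  open import Tactic.RingSolver using (solve-∀; solve)
  open import Tactic.RingSolver.Core.AlmostCommutativeRing using (AlmostCommutativeRing; fromCommutativeRing)
  open import Defs using (ℕtoℚ; _^ℚ_)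

  ℚ-ring : AlmostCommutativeRing 0ℓ 0ℓ
  ℚ-ring = fromCommutativeRing +-*-commutativeRing (λ p → dec⇒maybe (0ℚ ≟ p))

  ℕtoℚ-mkℚ : ∀ m → ℕtoℚ m ≡ mkℚ (+ m) 0 (Coprimality.sym (Coprimality.1-coprimeTo m))
  ℕtoℚ-mkℚ m = normalize-coprime (Coprimality.sym (Coprimality.1-coprimeTo m))

  ℕtoℚ-homo-+ : ∀ m n → ℕtoℚ (m ℕ.+ n) ≡ ℕtoℚ m + ℕtoℚ n
  ℕtoℚ-homo-+ m n rewrite ℕtoℚ-mkℚ m | ℕtoℚ-mkℚ n =
    cong (_/ 1) (trans (ℤₚ.pos-+ m n) (sym (cong₂ ℤ._+_ (ℤₚ.*-identityʳ (+ m)) (ℤₚ.*-identityʳ (+ n)))))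

  ℕtoℚ-homo-* : ∀ m n → ℕtoℚ (m ℕ.* n) ≡ ℕtoℚ m * ℕtoℚ n
  ℕtoℚ-homo-* m n rewrite ℕtoℚ-mkℚ m | ℕtoℚ-mkℚ n = cong (_/ 1) (ℤₚ.pos-* m n)

  ℕtoℚ-homo-^ : ∀ m r → ℕtoℚ (m ℕ.^ r) ≡ ℕtoℚ m ^ℚ r
  ℕtoℚ-homo-^ m zero    = refl
  ℕtoℚ-homo-^ m (suc r) = trans (ℕtoℚ-homo-* m (m ℕ.^ r)) (cong (ℕtoℚ m *_) (ℕtoℚ-homo-^ m r))

  ℕtoℚ-mono-≤ : ∀ {m n} → m ℕ.≤ n → ℕtoℚ m ≤ ℕtoℚ n
  ℕtoℚ-mono-≤ {m} {n} m≤n rewrite ℕtoℚ-mkℚ m | ℕtoℚ-mkℚ n =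
    *≤* (ℤₚ.*-monoʳ-≤-nonNeg (+ 1) (ℤ.+≤+ m≤n))

  0≤ℕtoℚ : ∀ m → 0ℚ ≤ ℕtoℚ m
  0≤ℕtoℚ m = ℕtoℚ-mono-≤ {0} {m} ℕ.z≤n

  ℕtoℚ-positive : ∀ {m} → 1 ℕ.≤ m → 0ℚ < ℕtoℚ m
  ℕtoℚ-positive 1≤m = <-≤-trans (*<* (ℤ.+<+ (ℕ.s≤s ℕ.z≤n))) (ℕtoℚ-mono-≤ 1≤m)

  /-*-ℕtoℚ : ∀ m n → (+ m) / suc n * ℕtoℚ (suc n) ≡ ℕtoℚ m
  /-*-ℕtoℚ m n = toℚᵘ-injective (begin
      toℚᵘ ((+ m) / suc n * ℕtoℚ (suc n))
    ≈⟨ toℚᵘ-homo-* ((+ m) / suc n) (ℕtoℚ (suc n)) ⟩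
      toℚᵘ ((+ m) / suc n) ℚᵘ.* toℚᵘ (ℕtoℚ (suc n))
    ≈⟨ ℚᵘ.*-cong (toℚᵘ-fromℚᵘ (ℚᵘ.mkℚᵘ (+ m) n)) (ℚᵘ.≃-reflexive (cong toℚᵘ (ℕtoℚ-mkℚ (suc n)))) ⟩
      ℚᵘ.mkℚᵘ (+ m) n ℚᵘ.* ℚᵘ.mkℚᵘ (+ suc n) 0
    ≈⟨ ℚᵘ.*≡* (ℤₚ.*-assoc (+ m) (+ suc n) (+ 1)) ⟩
      ℚᵘ.mkℚᵘ (+ m) 0
    ≡⟨ cong toℚᵘ (ℕtoℚ-mkℚ m) ⟨
      toℚᵘ (ℕtoℚ m)
    ∎)
    where open ℚᵘ.≃-Reasoning

  ℕtoℚ-∸ : ∀ {m n} → n ℕ.≤ m → ℕtoℚ (m ℕ.∸ n) ≡ ℕtoℚ m - ℕtoℚ n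
  ℕtoℚ-∸ {m} {n} n≤m = begin
      ℕtoℚ (m ℕ.∸ n)                    ≡⟨ cancel (ℕtoℚ (m ℕ.∸ n)) (ℕtoℚ n) ⟨
      ℕtoℚ (m ℕ.∸ n) + ℕtoℚ n - ℕtoℚ n  ≡⟨ cong (_- ℕtoℚ n) (sym (ℕtoℚ-homo-+ (m ℕ.∸ n) n)) ⟩
      ℕtoℚ (m ℕ.∸ n ℕ.+ n) - ℕtoℚ n     ≡⟨ cong (λ i → ℕtoℚ i - ℕtoℚ n) (ℕₚ.m∸n+n≡m n≤m) ⟩
      ℕtoℚ m - ℕtoℚ n                   ∎
    where
    open ≡-Reasoning
    cancel : ∀ x y → x + y - y ≡ x
    cancel = solve-∀ ℚ-ring

  ℕtoℚ-∣-∣-square : ∀ m n → ℕtoℚ ℕ.∣ m - n ∣ * ℕtoℚ ℕ.∣ m - n ∣ ≡ (ℕtoℚ m - ℕtoℚ n) * (ℕtoℚ m - ℕtoℚ n)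
  ℕtoℚ-∣-∣-square m n with ℕₚ.≤-total n m
  ... | inj₁ n≤m = cong (λ x → x * x) (trans (cong ℕtoℚ (ℕₚ.m≤n⇒∣n-m∣≡n∸m n≤m)) (ℕtoℚ-∸ n≤m))
  ... | inj₂ m≤n = trans (cong (λ x → x * x) (trans (cong ℕtoℚ (ℕₚ.m≤n⇒∣m-n∣≡n∸m m≤n)) (ℕtoℚ-∸ m≤n)))
                         (swap (ℕtoℚ n) (ℕtoℚ m))
    where
    swap : ∀ x y → (x - y) * (x - y) ≡ (y - x) * (y - x)
    swap = solve-∀ ℚ-ring

  module _ {p q : ℚ} where

    p≤q⇒0≤q-p : p ≤ q → 0ℚ ≤ q - p
    p≤q⇒0≤q-p p≤q = ≤-trans (≤-reflexive (sym (+-inverseʳ p))) (+-monoˡ-≤ (- p) p≤q)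

    0≤q-p⇒p≤q : 0ℚ ≤ q - p → p ≤ q
    0≤q-p⇒p≤q 0≤q-p = begin
        p            ≡⟨ +-identityˡ p ⟨
        0ℚ + p       ≤⟨ +-monoˡ-≤ p 0≤q-p ⟩
        q - p + p    ≡⟨ solve (p ∷ q ∷ []) ℚ-ring ⟩
        q            ∎
      where open ≤-Reasoning

    ≤-by-gap : ∀ r → q - p ≡ r → 0ℚ ≤ r → p ≤ q
    ≤-by-gap r q-p≡r 0≤r = 0≤q-p⇒p≤q (≤-trans 0≤r (≤-reflexive (sym q-p≡r)))

    p≤q+r⇒p-q≤r : ∀ {r} → p ≤ q + r → p - q ≤ r
    p≤q+r⇒p-q≤r {r} p≤q+r = ≤-trans (+-monoˡ-≤ (- q) p≤q+r) (≤-reflexive (cancel q r))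
      where
      cancel : ∀ q r → q + r - q ≡ r
      cancel = solve-∀ ℚ-ring

    *-pres-0≤ : 0ℚ ≤ p → 0ℚ ≤ q → 0ℚ ≤ p * q
    *-pres-0≤ 0≤p 0≤q = nonNegative⁻¹ _ {{nonNeg*nonNeg⇒nonNeg p {{nonNegative 0≤p}} q {{nonNegative 0≤q}}}}

  square-nonNeg : ∀ p → 0ℚ ≤ p * p
  square-nonNeg p with ≤-total 0ℚ p
  ... | inj₁ 0≤p = *-pres-0≤ 0≤p 0≤p
  ... | inj₂ p≤0 = ≤-trans (*-pres-0≤ 0≤-p 0≤-p) (≤-reflexive (solve (p ∷ []) ℚ-ring))
    where
    0≤-p : 0ℚ ≤ - p
    0≤-p = neg-antimono-≤ p≤0

  ^ℚ-pres-0≤ : ∀ {p} → 0ℚ ≤ p → ∀ r → 0ℚ ≤ p ^ℚ r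
  ^ℚ-pres-0≤ 0≤p zero    = 0≤ℕtoℚ 1
  ^ℚ-pres-0≤ 0≤p (suc r) = *-pres-0≤ 0≤p (^ℚ-pres-0≤ 0≤p r)

  *-monoˡ-≤-0≤ : ∀ {p q} r → 0ℚ ≤ r → p ≤ q → r * p ≤ r * q
  *-monoˡ-≤-0≤ r 0≤r = *-monoˡ-≤-nonNeg r {{nonNegative 0≤r}}

  *-mono-≤-0≤ : ∀ {p p′ q q′} → 0ℚ ≤ p → p ≤ p′ → 0ℚ ≤ q → q ≤ q′ → p * q ≤ p′ * q′
  *-mono-≤-0≤ {p} {p′} {q} {q′} 0≤p p≤p′ 0≤q q≤q′ =
    ≤-by-gap ((p′ - p) * q + p′ * (q′ - q)) (solve (p ∷ p′ ∷ q ∷ q′ ∷ []) ℚ-ring)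
      (+-mono-≤ (*-pres-0≤ (p≤q⇒0≤q-p p≤p′) 0≤q) (*-pres-0≤ (≤-trans 0≤p p≤p′) (p≤q⇒0≤q-p q≤q′)))

  square-mono-≤ : ∀ {p q} → - q ≤ p → p ≤ q → p * p ≤ q * q
  square-mono-≤ {p} {q} -q≤p p≤q =
    ≤-by-gap ((q - p) * (q + p)) (solve (p ∷ q ∷ []) ℚ-ring)
      (*-pres-0≤ (p≤q⇒0≤q-p p≤q) (≤-trans (p≤q⇒0≤q-p -q≤p) (≤-reflexive (solve (p ∷ q ∷ []) ℚ-ring))))

  ^ℚ-bernoulli : ∀ r {p q} → 0ℚ ≤ p → 0ℚ ≤ q →
    p ^ℚ suc r + q * (ℕtoℚ (suc r) * p ^ℚ r) ≤ (p + q) ^ℚ suc r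
  ^ℚ-bernoulli zero    {p} {q} _ _ = ≤-reflexive expand
    where
    expand : p * 1ℚ + q * (1ℚ * 1ℚ) ≡ (p + q) * 1ℚ
    expand = solve (p ∷ q ∷ []) ℚ-ring
  ^ℚ-bernoulli (suc r) {p} {q} 0≤p 0≤q = begin
      p ^ℚ suc (suc r) + q * (ℕtoℚ (2 ℕ.+ r) * p ^ℚ suc r)
    ≡⟨ cong (λ s → p ^ℚ suc (suc r) + q * (s * p ^ℚ suc r)) (ℕtoℚ-homo-+ 1 (suc r)) ⟩
      p * (p * pʳ) + q * ((1ℚ + R) * (p * pʳ))
    ≤⟨ ≤-by-gap (q * q * (R * pʳ)) (gap p q R pʳ)
         (*-pres-0≤ (*-pres-0≤ 0≤q 0≤q) (*-pres-0≤ (0≤ℕtoℚ (suc r)) (^ℚ-pres-0≤ 0≤p r))) ⟩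
      (p + q) * (p ^ℚ suc r + q * (R * pʳ))
    ≤⟨ *-monoˡ-≤-0≤ (p + q) (+-mono-≤ 0≤p 0≤q) (^ℚ-bernoulli r 0≤p 0≤q) ⟩
      (p + q) ^ℚ suc (suc r)
    ∎
    where
    open ≤-Reasoning
    R = ℕtoℚ (suc r)
    pʳ = p ^ℚ r
    gap : ∀ p q R pʳ → (p + q) * (p * pʳ + q * (R * pʳ)) - (p * (p * pʳ) + q * ((1ℚ + R) * (p * pʳ)))
                     ≡ q * q * (R * pʳ)
    gap = solve-∀ ℚ-ring

module FallingFactorial where
  open import Data.Nat
  open import Data.Nat.Properties
  open import Data.Nat.Tactic.RingSolver using (solve-∀)
  open import Relation.Binary.PropositionalEquality

  fallingFactorial : ℕ → ℕ → ℕ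
  fallingFactorial j       zero    = 1
  fallingFactorial zero    (suc r) = 0
  fallingFactorial (suc j) (suc r) = suc j * fallingFactorial j r

  fallingFactorial-1 : ∀ j → fallingFactorial j 1 ≡ j
  fallingFactorial-1 zero    = refl
  fallingFactorial-1 (suc j) = *-identityʳ (suc j)

  *-fallingFactorial : ∀ j r → j * fallingFactorial j r ≡ fallingFactorial j (suc r) + r * fallingFactorial j r
  *-fallingFactorial zero    zero    = refl
  *-fallingFactorial zero    (suc r) = sym (*-zeroʳ r)
  *-fallingFactorial (suc j) zero    = sym (+-identityʳ _)
  *-fallingFactorial (suc j) (suc r) = begin
      suc j * (F + j * F)              ≡⟨ cong (λ x → suc j * (F + x)) (*-fallingFactorial j r) ⟩
      suc j * (F + (G + r * F))        ≡⟨ regroup j r F G ⟩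
      suc j * G + suc r * (suc j * F)  ∎
    where
    open ≡-Reasoning
    F = fallingFactorial j r
    G = fallingFactorial j (suc r)
    regroup : ∀ j r F G → suc j * (F + (G + r * F)) ≡ suc j * G + suc r * (suc j * F)
    regroup = solve-∀

  fallingFactorial-suc : ∀ j r → fallingFactorial (suc j) (suc r) ≡ fallingFactorial j (suc r) + suc r * fallingFactorial j r
  fallingFactorial-suc j r = begin
      F + j * F        ≡⟨ cong (F +_) (*-fallingFactorial j r) ⟩
      F + (G + r * F)  ≡⟨ +-comm F (G + r * F) ⟩
      (G + r * F) + F  ≡⟨ +-assoc G (r * F) F ⟩
      G + (r * F + F)  ≡⟨ cong (G +_) (+-comm (r * F) F) ⟩
      G + suc r * F    ∎
    where
    open ≡-Reasoning
    F = fallingFactorial j r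
    G = fallingFactorial j (suc r)

  square≡fallingFactorial-2 : ∀ j → j * j ≡ fallingFactorial j 2 + j
  square≡fallingFactorial-2 j = begin
      j * j                                          ≡⟨ cong (j *_) (fallingFactorial-1 j) ⟨
      j * fallingFactorial j 1                       ≡⟨ *-fallingFactorial j 1 ⟩
      fallingFactorial j 2 + 1 * fallingFactorial j 1 ≡⟨ cong (λ x → fallingFactorial j 2 + x) (trans (*-identityˡ _) (fallingFactorial-1 j)) ⟩
      fallingFactorial j 2 + j                       ∎
    where open ≡-Reasoning

  fallingFactorial≤^ : ∀ j r → fallingFactorial j r ≤ j ^ r
  fallingFactorial≤^ j       zero    = ≤-refl
  fallingFactorial≤^ zero    (suc r) = z≤n
  fallingFactorial≤^ (suc j) (suc r) = *-monoʳ-≤ (suc j) (≤-trans (fallingFactorial≤^ j r) (^-monoˡ-≤ r (n≤1+n j)))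

  ^≤fallingFactorial : ∀ j r → j ^ r ≤ fallingFactorial (j + r) r
  ^≤fallingFactorial j zero    = ≤-refl
  ^≤fallingFactorial j (suc r) rewrite +-suc j r =
    *-mono-≤ (≤-trans (m≤m+n j r) (n≤1+n _)) (^≤fallingFactorial j r)

module BinomialMean where
  open import Data.List using ([]; _∷_)
  open import Data.Nat as ℕ using (ℕ; zero; suc; s≤s; z≤n)
  import Data.Nat.Properties as ℕₚ
  open import Data.Product using (_×_; _,_; proj₁; proj₂)
  open import Data.Rational
  open import Data.Rational.Properties
  open import Function using (_∘_)
  open import Relation.Binary.PropositionalEquality
  open import Defs using (ℕtoℚ; _^ℚ_)
  open import Tactic.RingSolver using (solve-∀; solve)
  open RationalArithmetic
  open FallingFactorial

  -- 𝔼 h(J) for J ~ Binomial(m, p), by conditioning on the last trial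
  binMean : ℚ → ℕ → (ℕ → ℚ) → ℚ
  binMean p zero    h = h 0
  binMean p (suc m) h = p * binMean p m (h ∘ suc) + (1ℚ - p) * binMean p m h

  module _ (p : ℚ) where

    binMean-cong : ∀ m {h₁ h₂ : ℕ → ℚ} → (∀ j → h₁ j ≡ h₂ j) → binMean p m h₁ ≡ binMean p m h₂
    binMean-cong zero    eq = eq 0
    binMean-cong (suc m) eq =
      cong₂ (λ x y → p * x + (1ℚ - p) * y) (binMean-cong m (eq ∘ suc)) (binMean-cong m eq)

    binMean-const : ∀ m c → binMean p m (λ _ → c) ≡ c
    binMean-const zero    c = refl
    binMean-const (suc m) c rewrite binMean-const m c = solve (p ∷ c ∷ []) ℚ-ring

    binMean-+ : ∀ m (h₁ h₂ : ℕ → ℚ) → binMean p m (λ j → h₁ j + h₂ j) ≡ binMean p m h₁ + binMean p m h₂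
    binMean-+ zero    h₁ h₂ = refl
    binMean-+ (suc m) h₁ h₂
      rewrite binMean-+ m (h₁ ∘ suc) (h₂ ∘ suc) | binMean-+ m h₁ h₂ = regroup p _ _ _ _
      where
      regroup : ∀ p x y z w → p * (x + y) + (1ℚ - p) * (z + w) ≡ p * x + (1ℚ - p) * z + (p * y + (1ℚ - p) * w)
      regroup = solve-∀ ℚ-ring

    binMean-scale : ∀ m a (h : ℕ → ℚ) → binMean p m (λ j → a * h j) ≡ a * binMean p m h
    binMean-scale zero    a h = refl
    binMean-scale (suc m) a h
      rewrite binMean-scale m a (h ∘ suc) | binMean-scale m a h = regroup p a _ _
      where
      regroup : ∀ p a x y → p * (a * x) + (1ℚ - p) * (a * y) ≡ a * (p * x + (1ℚ - p) * y)
      regroup = solve-∀ ℚ-ring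

    binMean-neg : ∀ m (h : ℕ → ℚ) → binMean p m (λ j → - h j) ≡ - binMean p m h
    binMean-neg m h = begin
        binMean p m (λ j → - h j)         ≡⟨ binMean-cong m (λ j → neg-as-scale (h j)) ⟩
        binMean p m (λ j → (- 1ℚ) * h j)  ≡⟨ binMean-scale m (- 1ℚ) h ⟩
        (- 1ℚ) * binMean p m h            ≡⟨ neg-as-scale (binMean p m h) ⟨
        - binMean p m h                   ∎
      where
      open ≡-Reasoning
      neg-as-scale : ∀ x → - x ≡ (- 1ℚ) * x
      neg-as-scale = solve-∀ ℚ-ring

    binMean-sub : ∀ m (h₁ h₂ : ℕ → ℚ) → binMean p m (λ j → h₁ j - h₂ j) ≡ binMean p m h₁ - binMean p m h₂
    binMean-sub m h₁ h₂ = trans (binMean-+ m h₁ (λ j → - h₂ j)) (cong (binMean p m h₁ +_) (binMean-neg m h₂))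

    binMean-suc : ∀ m (h : ℕ → ℚ) →
      binMean p (suc m) h ≡ binMean p m h + p * binMean p m (λ j → h (suc j) - h j)
    binMean-suc m h rewrite binMean-sub m (h ∘ suc) h = regroup p _ _
      where
      regroup : ∀ p x y → p * x + (1ℚ - p) * y ≡ y + p * (x - y)
      regroup = solve-∀ ℚ-ring

    binMean-ℕtoℚ : ∀ m → binMean p m ℕtoℚ ≡ ℕtoℚ m * p
    binMean-ℕtoℚ zero    = sym (*-zeroˡ p)
    binMean-ℕtoℚ (suc m) = begin
        binMean p (suc m) ℕtoℚ
      ≡⟨ binMean-suc m ℕtoℚ ⟩
        binMean p m ℕtoℚ + p * binMean p m (λ j → ℕtoℚ (suc j) - ℕtoℚ j)
      ≡⟨ cong₂ (λ x y → x + p * y) (binMean-ℕtoℚ m) (trans (binMean-cong m unit-step) (binMean-const m 1ℚ)) ⟩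
        ℕtoℚ m * p + p * 1ℚ
      ≡⟨ regroup (ℕtoℚ m) p ⟩
        (1ℚ + ℕtoℚ m) * p
      ≡⟨ cong (_* p) (ℕtoℚ-homo-+ 1 m) ⟨
        ℕtoℚ (suc m) * p
      ∎
      where
      open ≡-Reasoning
      unit-step : ∀ j → ℕtoℚ (suc j) - ℕtoℚ j ≡ 1ℚ
      unit-step j = trans (cong (_- ℕtoℚ j) (ℕtoℚ-homo-+ 1 j)) (cancel (ℕtoℚ j))
        where
        cancel : ∀ x → 1ℚ + x - x ≡ 1ℚ
        cancel = solve-∀ ℚ-ring
      regroup : ∀ m p → m * p + p * 1ℚ ≡ (1ℚ + m) * p
      regroup = solve-∀ ℚ-ring

  ℕtoℚ-fallingFactorial-suc : ∀ i r → ℕtoℚ (fallingFactorial (suc i) (suc r)) - ℕtoℚ (fallingFactorial i (suc r))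
                                      ≡ ℕtoℚ (suc r) * ℕtoℚ (fallingFactorial i r)
  ℕtoℚ-fallingFactorial-suc i r = begin
      ℕtoℚ (fallingFactorial (suc i) (suc r)) - G
    ≡⟨ cong (λ z → ℕtoℚ z - G) (fallingFactorial-suc i r) ⟩
      ℕtoℚ (fallingFactorial i (suc r) ℕ.+ suc r ℕ.* F) - G
    ≡⟨ cong (_- G) (ℕtoℚ-homo-+ (fallingFactorial i (suc r)) (suc r ℕ.* F)) ⟩
      G + ℕtoℚ (suc r ℕ.* F) - G
    ≡⟨ cancel G (ℕtoℚ (suc r ℕ.* F)) ⟩
      ℕtoℚ (suc r ℕ.* F)
    ≡⟨ ℕtoℚ-homo-* (suc r) F ⟩
      ℕtoℚ (suc r) * ℕtoℚ F
    ∎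
    where
    open ≡-Reasoning
    F = fallingFactorial i r
    G = ℕtoℚ (fallingFactorial i (suc r))
    cancel : ∀ x y → x + y - x ≡ y
    cancel = solve-∀ ℚ-ring

  ℕtoℚ-sub-square : ∀ j μ → (ℕtoℚ j - μ) * (ℕtoℚ j - μ)
                            ≡ ℕtoℚ (fallingFactorial j 2) + ((1ℚ - (μ + μ)) * ℕtoℚ j + μ * μ)
  ℕtoℚ-sub-square j μ = begin
      (x - μ) * (x - μ)                        ≡⟨ expand x μ ⟩
      x * x - x + ((1ℚ - (μ + μ)) * x + μ * μ)  ≡⟨ cong (λ s → s - x + ((1ℚ - (μ + μ)) * x + μ * μ)) square ⟩
      F₂ + x - x + ((1ℚ - (μ + μ)) * x + μ * μ) ≡⟨ cong (_+ ((1ℚ - (μ + μ)) * x + μ * μ)) (cancel F₂ x) ⟩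
      F₂ + ((1ℚ - (μ + μ)) * x + μ * μ)         ∎
    where
    open ≡-Reasoning
    x = ℕtoℚ j
    F₂ = ℕtoℚ (fallingFactorial j 2)
    square : x * x ≡ F₂ + x
    square = trans (sym (ℕtoℚ-homo-* j j))
      (trans (cong ℕtoℚ (square≡fallingFactorial-2 j)) (ℕtoℚ-homo-+ (fallingFactorial j 2) j))
    expand : ∀ x μ → (x - μ) * (x - μ) ≡ x * x - x + ((1ℚ - (μ + μ)) * x + μ * μ)
    expand = solve-∀ ℚ-ring
    cancel : ∀ x y → x + y - y ≡ x
    cancel = solve-∀ ℚ-ring

  module _ {p : ℚ} (0≤p : 0ℚ ≤ p) (0≤1-p : 0ℚ ≤ 1ℚ - p) where

    binMean-nonNeg : ∀ m {h : ℕ → ℚ} → (∀ j → j ℕ.≤ m → 0ℚ ≤ h j) → 0ℚ ≤ binMean p m h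
    binMean-nonNeg zero    0≤h = 0≤h 0 z≤n
    binMean-nonNeg (suc m) 0≤h = +-mono-≤
      (*-pres-0≤ 0≤p (binMean-nonNeg m (λ j j≤m → 0≤h (suc j) (s≤s j≤m))))
      (*-pres-0≤ 0≤1-p (binMean-nonNeg m (λ j j≤m → 0≤h j (ℕₚ.m≤n⇒m≤1+n j≤m))))

    binMean-mono : ∀ m {h₁ h₂ : ℕ → ℚ} → (∀ j → j ℕ.≤ m → h₁ j ≤ h₂ j) → binMean p m h₁ ≤ binMean p m h₂
    binMean-mono m {h₁} {h₂} h₁≤h₂ = 0≤q-p⇒p≤q (≤-trans
      (binMean-nonNeg m (λ j j≤m → p≤q⇒0≤q-p (h₁≤h₂ j j≤m)))
      (≤-reflexive (binMean-sub p m h₂ h₁)))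

    binMean-abs-≤ : ∀ m {φ U : ℕ → ℚ} → (∀ j → j ℕ.≤ m → - U j ≤ φ j × φ j ≤ U j) →
      - binMean p m U ≤ binMean p m φ × binMean p m φ ≤ binMean p m U
    binMean-abs-≤ m {φ} {U} bounds =
      ≤-trans (≤-reflexive (sym (binMean-neg p m U))) (binMean-mono m (λ j j≤m → proj₁ (bounds j j≤m))) ,
      binMean-mono m (λ j j≤m → proj₂ (bounds j j≤m))

    binMean-cauchySchwarz : ∀ m (u v : ℕ → ℚ) → 0ℚ < binMean p m (λ j → u j * u j) →
      binMean p m (λ j → u j * v j) * binMean p m (λ j → u j * v j)
        ≤ binMean p m (λ j → u j * u j) * binMean p m (λ j → v j * v j)
    binMean-cauchySchwarz m u v 0<a = 0≤q-p⇒p≤q (*-cancelˡ-≤-pos a {{positive 0<a}} (begin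
        a * 0ℚ                         ≡⟨ *-zeroʳ a ⟩
        0ℚ                             ≤⟨ binMean-nonNeg m (λ j _ → square-nonNeg (w j)) ⟩
        binMean p m (λ j → w j * w j)  ≡⟨ binMean-cong p m (λ j → expand a b (u j) (v j)) ⟩
        binMean p m (λ j → b * b * (u j * u j) + (- (a * b + a * b) * (u j * v j) + a * a * (v j * v j)))
          ≡⟨ trans (binMean-+ p m _ _) (cong₂ _+_ (binMean-scale p m (b * b) _) (trans (binMean-+ p m _ _)
               (cong₂ _+_ (binMean-scale p m (- (a * b + a * b)) (λ j → u j * v j)) (binMean-scale p m (a * a) (λ j → v j * v j))))) ⟩
        b * b * a + (- (a * b + a * b) * b + a * a * c)
          ≡⟨ regroup a b c ⟩
        a * (a * c - b * b)            ∎))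
      where
      open ≤-Reasoning
      a = binMean p m (λ j → u j * u j)
      b = binMean p m (λ j → u j * v j)
      c = binMean p m (λ j → v j * v j)
      w : ℕ → ℚ
      w j = b * u j - a * v j
      expand : ∀ a b u v → (b * u - a * v) * (b * u - a * v)
                           ≡ b * b * (u * u) + (- (a * b + a * b) * (u * v) + a * a * (v * v))
      expand = solve-∀ ℚ-ring
      regroup : ∀ a b c → b * b * a + (- (a * b + a * b) * b + a * a * c) ≡ a * (a * c - b * b)
      regroup = solve-∀ ℚ-ring

    binMean-fallingFactorial-≤ : ∀ m r a →
      binMean p m (λ j → ℕtoℚ (fallingFactorial (j ℕ.+ a) r)) ≤ (ℕtoℚ m * p + ℕtoℚ a) ^ℚ r
    binMean-fallingFactorial-≤ zero r a = begin
        ℕtoℚ (fallingFactorial a r)  ≤⟨ ℕtoℚ-mono-≤ (fallingFactorial≤^ a r) ⟩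
        ℕtoℚ (a ℕ.^ r)               ≡⟨ ℕtoℚ-homo-^ a r ⟩
        ℕtoℚ a ^ℚ r                  ≡⟨ cong (_^ℚ r) (trans (cong (_+ ℕtoℚ a) (*-zeroˡ p)) (+-identityˡ (ℕtoℚ a))) ⟨
        (0ℚ * p + ℕtoℚ a) ^ℚ r       ∎
      where open ≤-Reasoning
    binMean-fallingFactorial-≤ (suc m) zero a = ≤-reflexive (binMean-const p (suc m) 1ℚ)
    binMean-fallingFactorial-≤ (suc m) (suc r) a = begin
        binMean p (suc m) h
      ≡⟨ binMean-suc p m h ⟩
        binMean p m h + p * binMean p m (λ j → h (suc j) - h j)
      ≡⟨ cong (λ y → binMean p m h + p * y) (trans (binMean-cong p m (λ j → ℕtoℚ-fallingFactorial-suc (j ℕ.+ a) r)) (binMean-scale p m R h′)) ⟩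
        binMean p m h + p * (R * binMean p m h′)
      ≤⟨ +-mono-≤ (binMean-fallingFactorial-≤ m (suc r) a)
           (*-monoˡ-≤-0≤ p 0≤p (*-monoˡ-≤-0≤ R (0≤ℕtoℚ (suc r)) (binMean-fallingFactorial-≤ m r a))) ⟩
        x ^ℚ suc r + p * (R * x ^ℚ r)
      ≤⟨ ^ℚ-bernoulli r 0≤x 0≤p ⟩
        (x + p) ^ℚ suc r
      ≡⟨ cong (_^ℚ suc r) (regroup (ℕtoℚ m) p (ℕtoℚ a)) ⟩
        ((1ℚ + ℕtoℚ m) * p + ℕtoℚ a) ^ℚ suc r
      ≡⟨ cong (λ y → (y * p + ℕtoℚ a) ^ℚ suc r) (ℕtoℚ-homo-+ 1 m) ⟨
        (ℕtoℚ (suc m) * p + ℕtoℚ a) ^ℚ suc r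
      ∎
      where
      open ≤-Reasoning
      h h′ : ℕ → ℚ
      h  j = ℕtoℚ (fallingFactorial (j ℕ.+ a) (suc r))
      h′ j = ℕtoℚ (fallingFactorial (j ℕ.+ a) r)
      R = ℕtoℚ (suc r)
      x = ℕtoℚ m * p + ℕtoℚ a
      0≤x : 0ℚ ≤ x
      0≤x = +-mono-≤ (*-pres-0≤ (0≤ℕtoℚ m) 0≤p) (0≤ℕtoℚ a)
      regroup : ∀ m p a → m * p + a + p ≡ (1ℚ + m) * p + a
      regroup = solve-∀ ℚ-ring

    binMean-fallingFactorial-2-≤ : ∀ m → binMean p m (λ j → ℕtoℚ (fallingFactorial j 2)) ≤ ℕtoℚ m * p * (ℕtoℚ m * p)
    binMean-fallingFactorial-2-≤ m = begin
        binMean p m (λ j → ℕtoℚ (fallingFactorial j 2))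
      ≡⟨ binMean-cong p m (λ j → cong (λ i → ℕtoℚ (fallingFactorial i 2)) (ℕₚ.+-identityʳ j)) ⟨
        binMean p m (λ j → ℕtoℚ (fallingFactorial (j ℕ.+ 0) 2))
      ≤⟨ binMean-fallingFactorial-≤ m 2 0 ⟩
        (μ + 0ℚ) * ((μ + 0ℚ) * 1ℚ)
      ≡⟨ drop-units μ ⟩
        μ * μ
      ∎
      where
      open ≤-Reasoning
      μ = ℕtoℚ m * p
      drop-units : ∀ μ → (μ + 0ℚ) * ((μ + 0ℚ) * 1ℚ) ≡ μ * μ
      drop-units = solve-∀ ℚ-ring

    binMean-variance-≤ : ∀ m → let μ = ℕtoℚ m * p in
      binMean p m (λ j → (ℕtoℚ j - μ) * (ℕtoℚ j - μ)) ≤ μ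
    binMean-variance-≤ m = begin
        binMean p m (λ j → (ℕtoℚ j - μ) * (ℕtoℚ j - μ))
      ≡⟨ binMean-cong p m (λ j → ℕtoℚ-sub-square j μ) ⟩
        binMean p m (λ j → F₂ j + (c * ℕtoℚ j + μ * μ))
      ≡⟨ binMean-+ p m F₂ (λ j → c * ℕtoℚ j + μ * μ) ⟩
        binMean p m F₂ + binMean p m (λ j → c * ℕtoℚ j + μ * μ)
      ≡⟨ cong (binMean p m F₂ +_) (trans (binMean-+ p m (λ j → c * ℕtoℚ j) (λ _ → μ * μ))
           (cong₂ _+_ (trans (binMean-scale p m c ℕtoℚ) (cong (c *_) (binMean-ℕtoℚ p m))) (binMean-const p m (μ * μ)))) ⟩
        binMean p m F₂ + (c * μ + μ * μ)
      ≤⟨ +-monoˡ-≤ (c * μ + μ * μ) (binMean-fallingFactorial-2-≤ m) ⟩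
        μ * μ + (c * μ + μ * μ)
      ≡⟨ collapse μ ⟩
        μ
      ∎
      where
      open ≤-Reasoning
      μ = ℕtoℚ m * p
      c = 1ℚ - (μ + μ)
      F₂ : ℕ → ℚ
      F₂ j = ℕtoℚ (fallingFactorial j 2)
      collapse : ∀ μ → μ * μ + ((1ℚ - (μ + μ)) * μ + μ * μ) ≡ μ
      collapse = solve-∀ ℚ-ring

    binMean-power-≤ : ∀ m a r →
      binMean p m (λ j → ℕtoℚ ((j ℕ.+ a) ℕ.^ r)) ≤ (ℕtoℚ m * p + ℕtoℚ (a ℕ.+ r)) ^ℚ r
    binMean-power-≤ m a r = ≤-trans
      (binMean-mono m (λ j _ → ℕtoℚ-mono-≤ (ℕₚ.≤-trans (^≤fallingFactorial (j ℕ.+ a) r)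
        (ℕₚ.≤-reflexive (cong (λ i → fallingFactorial i r) (ℕₚ.+-assoc j a r))))))
      (binMean-fallingFactorial-≤ m r (a ℕ.+ r))

module BoundedIncrements where
  open import Data.Nat as ℕ using (ℕ; zero; suc; _∸_; ∣_-_∣)
  import Data.Nat.Properties as ℕₚ
  open import Data.Nat.Tactic.RingSolver using () renaming (solve-∀ to solve-∀-ℕ)
  open import Data.Product using (_×_; _,_; proj₁; proj₂)
  open import Data.Sum using (inj₁; inj₂)
  open import Data.Rational hiding (∣_∣)
  open import Data.Rational.Properties
  open import Relation.Binary.PropositionalEquality
  open import Defs using (ℕtoℚ; _^ℚ_)
  open import Tactic.RingSolver using (solve-∀)
  open RationalArithmetic
  open BinomialMean

  IncrementBounded : (ℕ → ℚ) → ℕ → ℕ → ℕ → Set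
  IncrementBounded F n c e = ∀ i → suc i ℕ.≤ n → F i ≤ F (suc i) × F (suc i) ≤ F i + ℕtoℚ (c ℕ.* suc i ℕ.^ e)

  spread : ℕ → ℕ → ℕ → ℕ → ℚ
  spread c e j k = ℕtoℚ (c ℕ.* (∣ j - k ∣ ℕ.* (j ℕ.+ k) ℕ.^ e))

  spread-comm : ∀ c e j k → spread c e j k ≡ spread c e k j
  spread-comm c e j k = cong₂ (λ d s → ℕtoℚ (c ℕ.* (d ℕ.* s ℕ.^ e))) (ℕₚ.∣-∣-comm j k) (ℕₚ.+-comm j k)

  0≤spread : ∀ c e j k → 0ℚ ≤ spread c e j k
  0≤spread c e j k = 0≤ℕtoℚ (c ℕ.* (∣ j - k ∣ ℕ.* (j ℕ.+ k) ℕ.^ e))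

  module _ {F : ℕ → ℚ} {n c e : ℕ} (inc : IncrementBounded F n c e) where

    IncrementBounded-sum : ∀ a t → a ℕ.+ t ℕ.≤ n →
      F a ≤ F (a ℕ.+ t) × F (a ℕ.+ t) ≤ F a + ℕtoℚ (c ℕ.* (t ℕ.* (a ℕ.+ t) ℕ.^ e))
    IncrementBounded-sum a zero a+0≤n rewrite ℕₚ.+-identityʳ a =
      ≤-refl , ≤-trans (≤-reflexive (sym (+-identityʳ (F a)))) (+-monoʳ-≤ (F a) (0≤ℕtoℚ (c ℕ.* 0)))
    IncrementBounded-sum a (suc t) a+t<n rewrite ℕₚ.+-suc a t =
      ≤-trans (proj₁ ih) (proj₁ step) ,
      (begin
        F (suc b)                               ≤⟨ proj₂ step ⟩
        F b + ℕtoℚ (c ℕ.* suc b ℕ.^ e)          ≤⟨ +-monoˡ-≤ _ (proj₂ ih) ⟩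
        F a + ℕtoℚ (c ℕ.* (t ℕ.* b ℕ.^ e)) + ℕtoℚ (c ℕ.* suc b ℕ.^ e)
          ≡⟨ trans (+-assoc (F a) _ _) (cong (F a +_) (sym (ℕtoℚ-homo-+ (c ℕ.* (t ℕ.* b ℕ.^ e)) (c ℕ.* suc b ℕ.^ e)))) ⟩
        F a + ℕtoℚ (c ℕ.* (t ℕ.* b ℕ.^ e) ℕ.+ c ℕ.* suc b ℕ.^ e)
          ≤⟨ +-monoʳ-≤ (F a) (ℕtoℚ-mono-≤ (ℕₚ.≤-trans (ℕₚ.+-monoˡ-≤ _ (ℕₚ.*-monoʳ-≤ c (ℕₚ.*-monoʳ-≤ t (ℕₚ.^-monoˡ-≤ e (ℕₚ.n≤1+n b)))))
                                             (ℕₚ.≤-reflexive (regroup c t (suc b ℕ.^ e))))) ⟩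
        F a + ℕtoℚ (c ℕ.* (suc t ℕ.* suc b ℕ.^ e))  ∎)
      where
      open ≤-Reasoning
      b = a ℕ.+ t
      ih = IncrementBounded-sum a t (ℕₚ.<⇒≤ a+t<n)
      step = inc b a+t<n
      regroup : ∀ c t s → c ℕ.* (t ℕ.* s) ℕ.+ c ℕ.* s ≡ c ℕ.* (suc t ℕ.* s)
      regroup = solve-∀-ℕ

    IncrementBounded-ordered : ∀ {j k} → k ℕ.≤ j → j ℕ.≤ n → 0ℚ ≤ F j - F k × F j - F k ≤ spread c e j k
    IncrementBounded-ordered {j} {k} k≤j j≤n
      with IncrementBounded-sum k (j ∸ k) (subst (ℕ._≤ n) (sym (ℕₚ.m+[n∸m]≡n k≤j)) j≤n)
    ... | lower , upper rewrite ℕₚ.m+[n∸m]≡n k≤j =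
      p≤q⇒0≤q-p lower ,
      ≤-trans (p≤q+r⇒p-q≤r upper) (ℕtoℚ-mono-≤ (ℕₚ.*-monoʳ-≤ c (ℕₚ.*-mono-≤ (ℕₚ.≤-reflexive (sym (ℕₚ.m≤n⇒∣n-m∣≡n∸m k≤j)))
                                                                      (ℕₚ.^-monoˡ-≤ e (ℕₚ.m≤m+n j k)))))

    IncrementBounded-∣-∣ : ∀ {j k} → j ℕ.≤ n → k ℕ.≤ n → - spread c e j k ≤ F j - F k × F j - F k ≤ spread c e j k
    IncrementBounded-∣-∣ {j} {k} j≤n k≤n with ℕₚ.≤-total k j
    ... | inj₁ k≤j = let (0≤Δ , Δ≤s) = IncrementBounded-ordered k≤j j≤n in
      ≤-trans (neg-antimono-≤ (0≤spread c e j k)) 0≤Δ , Δ≤s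
    ... | inj₂ j≤k = let (0≤Δ , Δ≤s) = IncrementBounded-ordered j≤k k≤n in
      ≤-trans (neg-antimono-≤ (≤-trans Δ≤s (≤-reflexive (spread-comm c e k j)))) (≤-reflexive (flip (F k) (F j))) ,
      ≤-trans (≤-reflexive (sym (flip (F k) (F j)))) (≤-trans (neg-antimono-≤ 0≤Δ) (0≤spread c e j k))
      where
      flip : ∀ x y → - (x - y) ≡ y - x
      flip = solve-∀ ℚ-ring

  ^-distribʳ-* : ∀ m n o → (m ℕ.* n) ℕ.^ o ≡ m ℕ.^ o ℕ.* n ℕ.^ o
  ^-distribʳ-* m n zero    = refl
  ^-distribʳ-* m n (suc o) = trans (cong (m ℕ.* n ℕ.*_) (^-distribʳ-* m n o)) (regroup m n (m ℕ.^ o) (n ℕ.^ o))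
    where
    regroup : ∀ m n a b → m ℕ.* n ℕ.* (a ℕ.* b) ≡ m ℕ.* a ℕ.* (n ℕ.* b)
    regroup = solve-∀-ℕ

  c²-Zₙ-k²-regroup : ∀ c r k → c ℕ.* c ℕ.* k ℕ.* (((2 ℕ.+ r) ℕ.* k) ℕ.^ r ℕ.* k)
                                ≡ c ℕ.* c ℕ.* (2 ℕ.+ r) ℕ.^ r ℕ.* k ℕ.^ (r ℕ.+ 2)
  c²-Zₙ-k²-regroup c r k = begin
      c ℕ.* c ℕ.* k ℕ.* (((2 ℕ.+ r) ℕ.* k) ℕ.^ r ℕ.* k)
    ≡⟨ cong (λ z → c ℕ.* c ℕ.* k ℕ.* (z ℕ.* k)) (^-distribʳ-* (2 ℕ.+ r) k r) ⟩
      c ℕ.* c ℕ.* k ℕ.* ((2 ℕ.+ r) ℕ.^ r ℕ.* k ℕ.^ r ℕ.* k)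
    ≡⟨ regroup c k ((2 ℕ.+ r) ℕ.^ r) (k ℕ.^ r) ⟩
      c ℕ.* c ℕ.* (2 ℕ.+ r) ℕ.^ r ℕ.* (k ℕ.^ r ℕ.* (k ℕ.* (k ℕ.* 1)))
    ≡⟨ cong (c ℕ.* c ℕ.* (2 ℕ.+ r) ℕ.^ r ℕ.*_) (ℕₚ.^-distribˡ-+-* k r 2) ⟨
      c ℕ.* c ℕ.* (2 ℕ.+ r) ℕ.^ r ℕ.* k ℕ.^ (r ℕ.+ 2)
    ∎
    where
    open ≡-Reasoning
    regroup : ∀ c k a b → c ℕ.* c ℕ.* k ℕ.* (a ℕ.* b ℕ.* k) ≡ c ℕ.* c ℕ.* a ℕ.* (b ℕ.* (k ℕ.* (k ℕ.* 1)))
    regroup = solve-∀-ℕ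

  module _ {F : ℕ → ℚ} {n c e k : ℕ} {p : ℚ} (inc : IncrementBounded F n c e)
           (0≤p : 0ℚ ≤ p) (0≤1-p : 0ℚ ≤ 1ℚ - p) (np≡k : ℕtoℚ n * p ≡ ℕtoℚ k)
           (1≤k : 1 ℕ.≤ k) (k≤n : k ℕ.≤ n) where

    private
      r = e ℕ.+ e
      K = ℕtoℚ k
      Z = ℕtoℚ (((2 ℕ.+ r) ℕ.* k) ℕ.^ r)
      ψ d : ℕ → ℚ
      ψ j = ℕtoℚ ((j ℕ.+ k) ℕ.^ e)
      d j = ℕtoℚ ∣ j - k ∣

      ψ-square : ∀ j → ψ j * ψ j ≡ ℕtoℚ ((j ℕ.+ k) ℕ.^ r)
      ψ-square j = trans (sym (ℕtoℚ-homo-* ((j ℕ.+ k) ℕ.^ e) ((j ℕ.+ k) ℕ.^ e)))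
                         (cong ℕtoℚ (sym (ℕₚ.^-distribˡ-+-* (j ℕ.+ k) e e)))

      binMean-gap-square-≤ : (F k - binMean p n F) * (F k - binMean p n F)
                             ≤ binMean p n (λ j → spread c e j k) * binMean p n (λ j → spread c e j k)
      binMean-gap-square-≤ = begin
          (F k - binMean p n F) * (F k - binMean p n F)
        ≡⟨ trans (swap (F k) (binMean p n F)) (cong (λ x → x * x) (sym binMean-φ)) ⟩
          binMean p n φ * binMean p n φ
        ≤⟨ square-mono-≤ (proj₁ φ-bounds) (proj₂ φ-bounds) ⟩
          binMean p n (λ j → spread c e j k) * binMean p n (λ j → spread c e j k)
        ∎
        where
        open ≤-Reasoning
        φ : ℕ → ℚ
        φ j = F j - F k
        swap : ∀ x y → (x - y) * (x - y) ≡ (y - x) * (y - x)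
        swap = solve-∀ ℚ-ring
        binMean-φ : binMean p n φ ≡ binMean p n F - F k
        binMean-φ = trans (binMean-sub p n F (λ _ → F k)) (cong (λ x → binMean p n F - x) (binMean-const p n (F k)))
        φ-bounds = binMean-abs-≤ 0≤p 0≤1-p n (λ j j≤n → IncrementBounded-∣-∣ {F} {n} {c} {e} inc j≤n k≤n)

      binMean-spread : binMean p n (λ j → spread c e j k) ≡ ℕtoℚ c * binMean p n (λ j → ψ j * d j)
      binMean-spread = trans (binMean-cong p n factor) (binMean-scale p n (ℕtoℚ c) (λ j → ψ j * d j))
        where
        factor : ∀ j → spread c e j k ≡ ℕtoℚ c * (ψ j * d j)
        factor j = trans (ℕtoℚ-homo-* c (∣ j - k ∣ ℕ.* (j ℕ.+ k) ℕ.^ e))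
          (cong (ℕtoℚ c *_) (trans (ℕtoℚ-homo-* ∣ j - k ∣ ((j ℕ.+ k) ℕ.^ e)) (*-comm (d j) (ψ j))))

      binMean-ψ²-positive : 0ℚ < binMean p n (λ j → ψ j * ψ j)
      binMean-ψ²-positive = <-≤-trans (ℕtoℚ-positive {1} ℕₚ.≤-refl) (begin
          1ℚ                             ≡⟨ binMean-const p n 1ℚ ⟨
          binMean p n (λ _ → 1ℚ)         ≤⟨ binMean-mono 0≤p 0≤1-p n (λ j _ → ≤-trans (ℕtoℚ-mono-≤ (1≤ j)) (≤-reflexive (sym (ψ-square j)))) ⟩
          binMean p n (λ j → ψ j * ψ j)  ∎)
        where
        open ≤-Reasoning
        1≤ : ∀ j → 1 ℕ.≤ (j ℕ.+ k) ℕ.^ r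
        1≤ j = ℕₚ.≤-trans (ℕₚ.≤-reflexive (sym (ℕₚ.^-zeroˡ r))) (ℕₚ.^-monoˡ-≤ r (ℕₚ.≤-trans 1≤k (ℕₚ.m≤n+m k j)))

      binMean-ψ²-≤ : binMean p n (λ j → ψ j * ψ j) ≤ Z
      binMean-ψ²-≤ = begin
          binMean p n (λ j → ψ j * ψ j)               ≡⟨ binMean-cong p n ψ-square ⟩
          binMean p n (λ j → ℕtoℚ ((j ℕ.+ k) ℕ.^ r))  ≤⟨ binMean-power-≤ 0≤p 0≤1-p n k r ⟩
          (ℕtoℚ n * p + ℕtoℚ (k ℕ.+ r)) ^ℚ r          ≡⟨ cong (λ x → (x + ℕtoℚ (k ℕ.+ r)) ^ℚ r) np≡k ⟩
          (K + ℕtoℚ (k ℕ.+ r)) ^ℚ r                   ≡⟨ cong (_^ℚ r) (ℕtoℚ-homo-+ k (k ℕ.+ r)) ⟨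
          ℕtoℚ (k ℕ.+ (k ℕ.+ r)) ^ℚ r                 ≡⟨ ℕtoℚ-homo-^ (k ℕ.+ (k ℕ.+ r)) r ⟨
          ℕtoℚ ((k ℕ.+ (k ℕ.+ r)) ℕ.^ r)              ≤⟨ ℕtoℚ-mono-≤ (ℕₚ.^-monoˡ-≤ r base≤) ⟩
          Z                                           ∎
        where
        open ≤-Reasoning
        regroup : ∀ k r → k ℕ.+ (k ℕ.+ r ℕ.* k) ≡ (2 ℕ.+ r) ℕ.* k
        regroup = solve-∀-ℕ
        base≤ : k ℕ.+ (k ℕ.+ r) ℕ.≤ (2 ℕ.+ r) ℕ.* k
        base≤ = ℕₚ.≤-trans (ℕₚ.+-monoʳ-≤ k (ℕₚ.+-monoʳ-≤ k (ℕₚ.≤-trans (ℕₚ.≤-reflexive (sym (ℕₚ.*-identityʳ r))) (ℕₚ.*-monoʳ-≤ r 1≤k))))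
                           (ℕₚ.≤-reflexive (regroup k r))

      binMean-d²-≤ : binMean p n (λ j → d j * d j) ≤ K
      binMean-d²-≤ = begin
          binMean p n (λ j → d j * d j)
        ≡⟨ binMean-cong p n (λ j → trans (ℕtoℚ-∣-∣-square j k) (cong (λ μ → (ℕtoℚ j - μ) * (ℕtoℚ j - μ)) (sym np≡k))) ⟩
          binMean p n (λ j → (ℕtoℚ j - ℕtoℚ n * p) * (ℕtoℚ j - ℕtoℚ n * p))
        ≤⟨ binMean-variance-≤ 0≤p 0≤1-p n ⟩
          ℕtoℚ n * p
        ≡⟨ np≡k ⟩
          K
        ∎
        where open ≤-Reasoning

      binMean-ψd-square-≤ : binMean p n (λ j → ψ j * d j) * binMean p n (λ j → ψ j * d j) ≤ Z * K
      binMean-ψd-square-≤ = ≤-trans (binMean-cauchySchwarz 0≤p 0≤1-p n ψ d binMean-ψ²-positive)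
        (*-mono-≤-0≤ (binMean-nonNeg 0≤p 0≤1-p n (λ j _ → square-nonNeg (ψ j))) binMean-ψ²-≤
                     (binMean-nonNeg 0≤p 0≤1-p n (λ j _ → square-nonNeg (d j))) binMean-d²-≤)

    binMean-gap-≤ : (F k - binMean p n F) * (F k - binMean p n F) * K
                    ≤ ℕtoℚ (c ℕ.* c ℕ.* (2 ℕ.+ r) ℕ.^ r ℕ.* k ℕ.^ (r ℕ.+ 2))
    binMean-gap-≤ = begin
        (F k - binMean p n F) * (F k - binMean p n F) * K
      ≤⟨ *-monoʳ-≤-nonNeg K {{nonNegative (0≤ℕtoℚ k)}} binMean-gap-square-≤ ⟩
        binMean p n (λ j → spread c e j k) * binMean p n (λ j → spread c e j k) * K
      ≡⟨ trans (cong (λ x → x * x * K) binMean-spread) (regroup C B K) ⟩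
        C * C * K * (B * B)
      ≤⟨ *-monoˡ-≤-0≤ (C * C * K) (*-pres-0≤ (*-pres-0≤ (0≤ℕtoℚ c) (0≤ℕtoℚ c)) (0≤ℕtoℚ k)) binMean-ψd-square-≤ ⟩
        C * C * K * (Z * K)
      ≡⟨ ℕtoℚ-homo ⟨
        ℕtoℚ (c ℕ.* c ℕ.* k ℕ.* (Zₙ ℕ.* k))
      ≡⟨ cong ℕtoℚ (c²-Zₙ-k²-regroup c r k) ⟩
        ℕtoℚ (c ℕ.* c ℕ.* (2 ℕ.+ r) ℕ.^ r ℕ.* k ℕ.^ (r ℕ.+ 2))
      ∎
      where
      open ≤-Reasoning
      C = ℕtoℚ c
      B = binMean p n (λ j → ψ j * d j)
      Zₙ = ((2 ℕ.+ r) ℕ.* k) ℕ.^ r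
      regroup : ∀ C B K → C * B * (C * B) * K ≡ C * C * K * (B * B)
      regroup = solve-∀ ℚ-ring
      ℕtoℚ-homo : ℕtoℚ (c ℕ.* c ℕ.* k ℕ.* (Zₙ ℕ.* k)) ≡ C * C * K * (Z * K)
      ℕtoℚ-homo = trans (ℕtoℚ-homo-* (c ℕ.* c ℕ.* k) (Zₙ ℕ.* k)) (cong₂ _*_
        (trans (ℕtoℚ-homo-* (c ℕ.* c) k) (cong (_* K) (ℕtoℚ-homo-* c c))) (ℕtoℚ-homo-* Zₙ k))

module ListSum {c ℓ} (R : CommutativeSemiring c ℓ) where
  open import Algebra.Properties.CommutativeSemigroup (CommutativeSemiring.+-commutativeSemigroup R)
    using (x∙yz≈y∙xz)
  open import Data.List using (List; []; _∷_; map; foldr; _++_)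
  import Data.List.Properties as List
  open import Data.List.Relation.Unary.All using (All; []; _∷_)
  open import Function using (_∘_)
  open import Relation.Binary.PropositionalEquality as ≡ using (_≡_)
  open CommutativeSemiring R
  open import Relation.Binary.Reasoning.Setoid setoid

  sumOf : ∀ {a} {A : Set a} → (A → Carrier) → List A → Carrier
  sumOf f xs = foldr _+_ 0# (map f xs)

  module _ {a} {A : Set a} where

    sumOf-++ : ∀ (f : A → Carrier) xs ys → sumOf f (xs ++ ys) ≈ sumOf f xs + sumOf f ys
    sumOf-++ f []       ys = sym (+-identityˡ _)
    sumOf-++ f (x ∷ xs) ys = begin
      f x + sumOf f (xs ++ ys)         ≈⟨ +-congˡ (sumOf-++ f xs ys) ⟩
      f x + (sumOf f xs + sumOf f ys)  ≈⟨ +-assoc _ _ _ ⟨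
      f x + sumOf f xs + sumOf f ys    ∎

    sumOf-map : ∀ {b} {B : Set b} (f : B → Carrier) (h : A → B) xs → sumOf f (map h xs) ≡ sumOf (f ∘ h) xs
    sumOf-map f h xs = ≡.cong (foldr _+_ 0#) (≡.sym (List.map-∘ xs))

    sumOf-cong : ∀ {f h : A → Carrier} xs → All (λ x → f x ≈ h x) xs → sumOf f xs ≈ sumOf h xs
    sumOf-cong []       []            = refl
    sumOf-cong (x ∷ xs) (fx≈hx ∷ eqs) = +-cong fx≈hx (sumOf-cong xs eqs)

    sumOf-+ : ∀ (f h : A → Carrier) xs → sumOf (λ x → f x + h x) xs ≈ sumOf f xs + sumOf h xs
    sumOf-+ f h []       = sym (+-identityˡ 0#)
    sumOf-+ f h (x ∷ xs) = begin
      f x + h x + sumOf (λ x → f x + h x) xs  ≈⟨ +-congˡ (sumOf-+ f h xs) ⟩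
      f x + h x + (sumOf f xs + sumOf h xs)   ≈⟨ +-assoc _ _ _ ⟩
      f x + (h x + (sumOf f xs + sumOf h xs)) ≈⟨ +-congˡ (x∙yz≈y∙xz (h x) (sumOf f xs) (sumOf h xs)) ⟩
      f x + (sumOf f xs + (h x + sumOf h xs)) ≈⟨ +-assoc _ _ _ ⟨
      f x + sumOf f xs + (h x + sumOf h xs)   ∎

    sumOf-*ˡ : ∀ r (f : A → Carrier) xs → sumOf (λ x → r * f x) xs ≈ r * sumOf f xs
    sumOf-*ˡ r f []       = sym (zeroʳ r)
    sumOf-*ˡ r f (x ∷ xs) = trans (+-congˡ (sumOf-*ˡ r f xs)) (sym (distribˡ r (f x) (sumOf f xs)))

module SubsetLevels where
  open import Data.Bool using (true; false)
  open import Data.List using (List; []; _∷_; map; _++_; length; filter)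
  import Data.List.Properties as List
  open import Data.List.Membership.Propositional using (_∈_)
  open import Data.List.Relation.Binary.Subset.Propositional using (_⊆_)
  open import Data.List.Relation.Unary.All as All using (All; []; _∷_)
  import Data.List.Relation.Unary.All.Properties as All
  open import Data.List.Relation.Unary.Any using (here; there)
  open import Data.Nat
  open import Data.Nat.ListAction using (sum)
  open import Data.Nat.Properties
  open import Data.Nat.Tactic.RingSolver using (solve-∀)
  open import Data.Product using (_×_; _,_; proj₁; proj₂)
  open import Data.Sum using (_⊎_; inj₁; inj₂)
  open import Function using (_∘_)
  open import Relation.Binary.PropositionalEquality
  open import Relation.Nullary using (yes; no)
  open import Defs using (subsets)
  open ListSum +-*-commutativeSemiring

  sum-map-const : ∀ {A : Set} c (xs : List A) → sum (map (λ _ → c) xs) ≡ length xs * c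
  sum-map-const c []       = refl
  sum-map-const c (x ∷ xs) = cong (c +_) (sum-map-const c xs)

  sum-map-mono : ∀ {A : Set} {f h : A → ℕ} {xs} → All (λ x → f x ≤ h x) xs → sum (map f xs) ≤ sum (map h xs)
  sum-map-mono []            = z≤n
  sum-map-mono (fx≤hx ∷ les) = +-mono-≤ fx≤hx (sum-map-mono les)

  module _ {A : Set} where

    ofSize : ℕ → List (List A) → List (List A)
    ofSize j = filter (λ B → length B ≟ j)

    subsetsOfSize : List A → ℕ → List (List A)
    subsetsOfSize L j = ofSize j (subsets L)

    levelSum : (List A → ℕ) → List A → ℕ → ℕ
    levelSum g L j = sum (map g (subsetsOfSize L j))

    levelCount : List A → ℕ → ℕ
    levelCount L j = length (subsetsOfSize L j)

    ofSize-length : ∀ j Bs → All (λ B → length B ≡ j) (ofSize j Bs)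
    ofSize-length j = All.all-filter (λ B → length B ≟ j)

    ofSize-map-∷ : ∀ x j Bs → ofSize (suc j) (map (x ∷_) Bs) ≡ map (x ∷_) (ofSize j Bs)
    ofSize-map-∷ x j []       = refl
    -- the filter's test on x ∷ B reduces to length B ≡ᵇ j
    ofSize-map-∷ x j (B ∷ Bs) with length B ≡ᵇ j
    ... | true  = cong ((x ∷ B) ∷_) (ofSize-map-∷ x j Bs)
    ... | false = ofSize-map-∷ x j Bs

    ofSize-zero-map-∷ : ∀ x Bs → ofSize 0 (map (x ∷_) Bs) ≡ []
    ofSize-zero-map-∷ x []       = refl
    ofSize-zero-map-∷ x (B ∷ Bs) = ofSize-zero-map-∷ x Bs

    subsetsOfSize-∷-suc : ∀ x L j → subsetsOfSize (x ∷ L) (suc j) ≡ map (x ∷_) (subsetsOfSize L j) ++ subsetsOfSize L (suc j)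
    subsetsOfSize-∷-suc x L j = trans (List.filter-++ (λ B → length B ≟ suc j) (map (x ∷_) (subsets L)) (subsets L))
                                      (cong (_++ subsetsOfSize L (suc j)) (ofSize-map-∷ x j (subsets L)))

    subsetsOfSize-∷-zero : ∀ x L → subsetsOfSize (x ∷ L) 0 ≡ subsetsOfSize L 0
    subsetsOfSize-∷-zero x L = trans (List.filter-++ (λ B → length B ≟ 0) (map (x ∷_) (subsets L)) (subsets L))
                                     (cong (_++ subsetsOfSize L 0) (ofSize-zero-map-∷ x (subsets L)))

    subsetsOfSize-zero : ∀ L → subsetsOfSize L 0 ≡ [] ∷ []
    subsetsOfSize-zero []      = refl
    subsetsOfSize-zero (x ∷ L) = trans (subsetsOfSize-∷-zero x L) (subsetsOfSize-zero L)

    subsetsOfSize-> : ∀ L j → length L < j → subsetsOfSize L j ≡ []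
    subsetsOfSize-> []      (suc j) _           = refl
    subsetsOfSize-> (x ∷ L) (suc j) (s≤s |L|<j) = trans (subsetsOfSize-∷-suc x L j)
      (cong₂ (λ Bs Cs → map (x ∷_) Bs ++ Cs) (subsetsOfSize-> L j |L|<j) (subsetsOfSize-> L (suc j) (m≤n⇒m≤1+n |L|<j)))

    levelCount-positive : ∀ L j → j ≤ length L → 1 ≤ levelCount L j
    levelCount-positive L       zero    _ rewrite subsetsOfSize-zero L = s≤s z≤n
    levelCount-positive (x ∷ L) (suc j) (s≤s j≤|L|) rewrite subsetsOfSize-∷-suc x L j =
      ≤-trans (levelCount-positive L j j≤|L|)
        (≤-trans (≤-reflexive (sym (List.length-map (x ∷_) (subsetsOfSize L j)))) (List.length-++-≤ˡ (map (x ∷_) (subsetsOfSize L j))))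

    levelSum-∷-suc : ∀ g x L j → levelSum g (x ∷ L) (suc j) ≡ levelSum (g ∘ (x ∷_)) L j + levelSum g L (suc j)
    levelSum-∷-suc g x L j rewrite subsetsOfSize-∷-suc x L j =
      trans (sumOf-++ g (map (x ∷_) (subsetsOfSize L j)) (subsetsOfSize L (suc j)))
            (cong (_+ levelSum g L (suc j)) (sumOf-map g (x ∷_) (subsetsOfSize L j)))

    deletions : List A → List (List A)
    deletions []       = []
    deletions (x ∷ xs) = xs ∷ map (x ∷_) (deletions xs)

    deletions-length : ∀ B → length (deletions B) ≡ length B
    deletions-length []      = refl
    deletions-length (x ∷ B) = cong suc (trans (List.length-map (x ∷_) (deletions B)) (deletions-length B))

    record Deletion (r B : List A) : Set where
      field
        ⊆-whole   : r ⊆ B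
        removed   : A
        ⊆-removed-∷  : B ⊆ removed ∷ r
        length-suc : suc (length r) ≡ length B

    deletions-Deletion : ∀ B → All (λ r → Deletion r B) (deletions B)
    deletions-Deletion []      = []
    deletions-Deletion (x ∷ B) = record { ⊆-whole = there ; removed = x ; ⊆-removed-∷ = λ y∈ → y∈ ; length-suc = refl }
                               ∷ All.map⁺ (All.map extend (deletions-Deletion B))
      where
      extend : ∀ {r} → Deletion r B → Deletion (x ∷ r) (x ∷ B)
      extend d = record
        { ⊆-whole   = λ { (here y≡x) → here y≡x ; (there y∈r) → there (⊆-whole y∈r) }
        ; removed   = removed
        ; ⊆-removed-∷  = λ { (here y≡x) → there (here y≡x) ; (there y∈B) → ∷-there (⊆-removed-∷ y∈B) }
        ; length-suc = cong suc length-suc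
        }
        where
        open Deletion d
        ∷-there : ∀ {y} → y ∈ removed ∷ _ → y ∈ removed ∷ x ∷ _
        ∷-there (here y≡b)  = here y≡b
        ∷-there (there y∈r) = there (there y∈r)

    sum-deletions-const : ∀ (h : List A → ℕ) j Bs → All (λ B → length B ≡ j) Bs →
      sum (map (λ B → sum (map (λ _ → h B) (deletions B))) Bs) ≡ j * sum (map h Bs)
    sum-deletions-const h j Bs lengths = begin
        sum (map (λ B → sum (map (λ _ → h B) (deletions B))) Bs)
      ≡⟨ sumOf-cong Bs (All.map (λ {B} |B|≡j → trans (sum-map-const (h B) (deletions B))
                                              (cong (_* h B) (trans (deletions-length B) |B|≡j))) lengths) ⟩
        sum (map (λ B → j * h B) Bs)
      ≡⟨ sumOf-*ˡ j h Bs ⟩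
        j * sum (map h Bs)
      ∎
      where open ≡-Reasoning

    deletionSum : (List A → ℕ) → List A → ℕ → ℕ
    deletionSum g L j = sum (map (λ B → sum (map g (deletions B))) (subsetsOfSize L j))

    deletionSum-zero : ∀ g L → deletionSum g L 0 ≡ 0
    deletionSum-zero g L rewrite subsetsOfSize-zero L = refl

    deletionSum-∷-suc : ∀ g x L j →
      deletionSum g (x ∷ L) (suc j) ≡ levelSum g L j + deletionSum (g ∘ (x ∷_)) L j + deletionSum g L (suc j)
    deletionSum-∷-suc g x L j = begin
        deletionSum g (x ∷ L) (suc j)
      ≡⟨ cong (sumOf φ) (subsetsOfSize-∷-suc x L j) ⟩
        sumOf φ (map (x ∷_) (subsetsOfSize L j) ++ subsetsOfSize L (suc j))
      ≡⟨ sumOf-++ φ (map (x ∷_) (subsetsOfSize L j)) (subsetsOfSize L (suc j)) ⟩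
        sumOf φ (map (x ∷_) (subsetsOfSize L j)) + deletionSum g L (suc j)
      ≡⟨ cong (_+ deletionSum g L (suc j)) (trans (sumOf-map φ (x ∷_) (subsetsOfSize L j)) (trans
           (sumOf-cong (subsetsOfSize L j) (All.tabulate (λ {B} _ → cong (g B +_) (sumOf-map g (x ∷_) (deletions B)))))
           (sumOf-+ g (λ B → sum (map (g ∘ (x ∷_)) (deletions B))) (subsetsOfSize L j)))) ⟩
        levelSum g L j + deletionSum (g ∘ (x ∷_)) L j + deletionSum g L (suc j)
      ∎
      where
      open ≡-Reasoning
      φ : List A → ℕ
      φ B = sum (map g (deletions B))

    -- every (j+1)-subset has j+1 deletions, and every j-subset extends in |L| - j ways
    deletionSum-doubleCount : ∀ g L j → deletionSum g L (suc j) ≡ (length L ∸ j) * levelSum g L j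
    deletionSum-doubleCount g []      zero    = refl
    deletionSum-doubleCount g []      (suc j) = refl
    deletionSum-doubleCount g (x ∷ L) j = trans (deletionSum-∷-suc g x L j) (step j)
      where
      g′ = g ∘ (x ∷_)
      ih : ∀ j → deletionSum g L (suc j) ≡ (length L ∸ j) * levelSum g L j
      ih = deletionSum-doubleCount g L
      step : ∀ j → levelSum g L j + deletionSum g′ L j + deletionSum g L (suc j)
                   ≡ (suc (length L) ∸ j) * levelSum g (x ∷ L) j
      step zero rewrite deletionSum-zero g′ L | ih zero | subsetsOfSize-∷-zero x L =
        cong (_+ length L * levelSum g L 0) (+-identityʳ (levelSum g L 0))
      step (suc i) rewrite deletionSum-doubleCount g′ L i | ih (suc i) | levelSum-∷-suc g x L i =
        redistribute (length L) i (levelSum g L (suc i)) (levelSum g′ L i) suc-i≤|L|⊎empty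
        where
        suc-i≤|L|⊎empty : suc i ≤ length L ⊎ levelSum g L (suc i) ≡ 0
        suc-i≤|L|⊎empty with suc i ≤? length L
        ... | yes le = inj₁ le
        ... | no  gt rewrite subsetsOfSize-> L (suc i) (≰⇒> gt) = inj₂ refl
        redistribute : ∀ a i S S′ → suc i ≤ a ⊎ S ≡ 0 → S + (a ∸ i) * S′ + (a ∸ suc i) * S ≡ (a ∸ i) * (S′ + S)
        redistribute a i S S′ (inj₁ le) rewrite +-∸-assoc 1 le = regroup S S′ (a ∸ suc i)
          where
          regroup : ∀ S S′ t → S + suc t * S′ + t * S ≡ suc t * (S′ + S)
          regroup = solve-∀
        redistribute a i S S′ (inj₂ refl) = regroup (a ∸ i) (a ∸ suc i) S′
          where
          regroup : ∀ t u S′ → 0 + t * S′ + u * 0 ≡ t * (S′ + 0)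
          regroup = solve-∀

    levelCount-doubleCount : ∀ L j → suc j * levelCount L (suc j) ≡ (length L ∸ j) * levelCount L j
    levelCount-doubleCount L j = begin
        suc j * levelCount L (suc j)
      ≡⟨ cong (suc j *_) (count (suc j)) ⟨
        suc j * levelSum (λ _ → 1) L (suc j)
      ≡⟨ sum-deletions-const (λ _ → 1) (suc j) (subsetsOfSize L (suc j)) (ofSize-length (suc j) (subsets L)) ⟨
        deletionSum (λ _ → 1) L (suc j)
      ≡⟨ deletionSum-doubleCount (λ _ → 1) L j ⟩
        (length L ∸ j) * levelSum (λ _ → 1) L j
      ≡⟨ cong ((length L ∸ j) *_) (count j) ⟩
        (length L ∸ j) * levelCount L j
      ∎
      where
      open ≡-Reasoning
      count : ∀ j → levelSum (λ _ → 1) L j ≡ levelCount L j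
      count j = trans (sum-map-const 1 (subsetsOfSize L j)) (*-identityʳ (levelCount L j))

    DeletionBounded : (List A → ℕ) → ℕ → ℕ → Set
    DeletionBounded g δ j = ∀ {r B} → length B ≡ suc j → Deletion r B → g r ≤ g B × g B ≤ g r + δ

    module _ {g : List A → ℕ} {δ j : ℕ} (bounded : DeletionBounded g δ j) (L : List A) where

      private
        Bs = subsetsOfSize L (suc j)

        deletions-bounded : All (λ B → All (λ r → g r ≤ g B × g B ≤ g r + δ) (deletions B)) Bs
        deletions-bounded = All.map (λ |B|≡ → All.map (bounded |B|≡) (deletions-Deletion _)) (ofSize-length (suc j) (subsets L))

      deletionSum-≤ : deletionSum g L (suc j) ≤ suc j * levelSum g L (suc j)
      deletionSum-≤ = begin
          deletionSum g L (suc j)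
        ≤⟨ sum-map-mono (All.map (λ rs → sum-map-mono (All.map proj₁ rs)) deletions-bounded) ⟩
          sum (map (λ B → sum (map (λ _ → g B) (deletions B))) Bs)
        ≡⟨ sum-deletions-const g (suc j) Bs (ofSize-length (suc j) (subsets L)) ⟩
          suc j * levelSum g L (suc j)
        ∎
        where open ≤-Reasoning

      deletionSum-≥ : suc j * levelSum g L (suc j) ≤ deletionSum g L (suc j) + suc j * (levelCount L (suc j) * δ)
      deletionSum-≥ = begin
          suc j * levelSum g L (suc j)
        ≡⟨ sum-deletions-const g (suc j) Bs (ofSize-length (suc j) (subsets L)) ⟨
          sum (map (λ B → sum (map (λ _ → g B) (deletions B))) Bs)
        ≤⟨ sum-map-mono (All.map (λ rs → sum-map-mono (All.map proj₂ rs)) deletions-bounded) ⟩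
          sum (map (λ B → sum (map (λ r → g r + δ) (deletions B))) Bs)
        ≡⟨ trans (sumOf-cong Bs (All.tabulate (λ {B} _ → sumOf-+ g (λ _ → δ) (deletions B))))
                 (sumOf-+ (λ B → sum (map g (deletions B))) (λ B → sum (map (λ _ → δ) (deletions B))) Bs) ⟩
          deletionSum g L (suc j) + sum (map (λ B → sum (map (λ _ → δ) (deletions B))) Bs)
        ≡⟨ cong (deletionSum g L (suc j) +_) (trans (sum-deletions-const (λ _ → δ) (suc j) Bs (ofSize-length (suc j) (subsets L)))
                                                    (cong (suc j *_) (sum-map-const δ Bs))) ⟩
          deletionSum g L (suc j) + suc j * (levelCount L (suc j) * δ)
        ∎
        where open ≤-Reasoning

module RatioSet where
  open import Data.List using (List; []; _∷_; map; _++_; length; concatMap; deduplicate; cartesianProductWith)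
  import Data.List.Properties as List
  open import Data.List.Membership.Propositional using (_∈_)
  open import Data.List.Membership.Propositional.Properties
    using (∈-map⁺; ∈-++⁺ˡ; ∈-++⁺ʳ; ∈-++⁻; ∈-deduplicate⁺; ∈-deduplicate⁻; ∈-cartesianProductWith⁺; ∈-cartesianProductWith⁻)
  open import Data.List.Relation.Binary.Subset.Propositional using (_⊆_)
  open import Data.List.Relation.Unary.All as All using (All; []; _∷_)
  open import Data.List.Relation.Unary.AllPairs using ([]; _∷_)
  open import Data.List.Relation.Unary.Any using (here; there; _─_)
  open import Data.List.Relation.Unary.Unique.Propositional using (Unique)
  import Data.List.Relation.Unary.Unique.DecPropositional.Properties as Unique
  open import Data.Nat
  open import Data.Nat.Properties
  open import Data.Nat.Tactic.RingSolver using (solve-∀)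
  open import Data.Product using (_×_; _,_; proj₁; proj₂)
  open import Data.Sum using (inj₁; inj₂)
  open import Relation.Binary.Definitions using (DecidableEquality)
  open import Relation.Binary.PropositionalEquality
  open import Relation.Nullary using (contradiction)
  open import Data.Rational.Base using (ℚ)
  import Data.Rational.Properties as ℚₚ
  open import Defs using (ratio; X)
  open SubsetLevels using (Deletion; DeletionBounded)

  module _ {A : Set} where

    ∈-─ : ∀ {x z : A} ys (x∈ys : x ∈ ys) → z ∈ ys → x ≢ z → z ∈ (ys ─ x∈ys)
    ∈-─ (y ∷ ys) (here x≡y)  (here z≡y)  x≢z = contradiction (trans x≡y (sym z≡y)) x≢z
    ∈-─ (y ∷ ys) (here _)    (there z∈ys) _  = z∈ys
    ∈-─ (y ∷ ys) (there _)   (here z≡y)  _   = here z≡y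
    ∈-─ (y ∷ ys) (there x∈ys) (there z∈ys) x≢z = there (∈-─ ys x∈ys z∈ys x≢z)

    Unique-⊆⇒length≤ : ∀ {xs ys : List A} → Unique xs → xs ⊆ ys → length xs ≤ length ys
    Unique-⊆⇒length≤ {[]}     []             _      = z≤n
    Unique-⊆⇒length≤ {x ∷ xs} {ys} (x∉xs ∷ uxs) xs⊆ys = begin
        suc (length xs)             ≤⟨ s≤s (Unique-⊆⇒length≤ uxs (λ z∈xs → ∈-─ ys x∈ys (xs⊆ys (there z∈xs)) (All.lookup x∉xs z∈xs))) ⟩
        suc (length (ys ─ x∈ys))    ≡⟨ List.length-removeAt′ ys _ ⟨
        length ys                   ∎
      where
      open ≤-Reasoning
      x∈ys = xs⊆ys (here refl)

  module _ {A : Set} (_≟_ : DecidableEquality A) where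

    length-deduplicate-⊆-++ : ∀ (xs ys zs : List A) → xs ⊆ ys ++ zs →
      length (deduplicate _≟_ xs) ≤ length (deduplicate _≟_ ys) + length zs
    length-deduplicate-⊆-++ xs ys zs xs⊆ys++zs = begin
        length (deduplicate _≟_ xs)              ≤⟨ Unique-⊆⇒length≤ (Unique.deduplicate-! _≟_ xs) into ⟩
        length (deduplicate _≟_ ys ++ zs)        ≡⟨ List.length-++ (deduplicate _≟_ ys) ⟩
        length (deduplicate _≟_ ys) + length zs  ∎
      where
      open ≤-Reasoning
      into : deduplicate _≟_ xs ⊆ deduplicate _≟_ ys ++ zs
      into z∈ with ∈-++⁻ ys (xs⊆ys++zs (∈-deduplicate⁻ _≟_ xs z∈))
      ... | inj₁ z∈ys = ∈-++⁺ˡ (∈-deduplicate⁺ _≟_ z∈ys)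
      ... | inj₂ z∈zs = ∈-++⁺ʳ (deduplicate _≟_ ys) z∈zs

  concatMap-map≡cartesianProductWith : ∀ {A B C : Set} (f : A → B → C) xs ys →
    concatMap (λ x → map (f x) ys) xs ≡ cartesianProductWith f xs ys
  concatMap-map≡cartesianProductWith f []       ys = refl
  concatMap-map≡cartesianProductWith f (x ∷ xs) ys = cong (map (f x) ys ++_) (concatMap-map≡cartesianProductWith f xs ys)

  length-cartesianProductWith : ∀ {A B C : Set} (f : A → B → C) xs ys →
    length (cartesianProductWith f xs ys) ≡ length xs * length ys
  length-cartesianProductWith f []       ys = refl
  length-cartesianProductWith f (x ∷ xs) ys = begin
      length (map (f x) ys ++ cartesianProductWith f xs ys)
    ≡⟨ List.length-++ (map (f x) ys) ⟩
      length (map (f x) ys) + length (cartesianProductWith f xs ys)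
    ≡⟨ cong₂ _+_ (List.length-map (f x) ys) (length-cartesianProductWith f xs ys) ⟩
      length ys + length xs * length ys
    ∎
    where open ≡-Reasoning

  ratios : List ℕ → List ℚ
  ratios A = cartesianProductWith ratio A A

  X≡ : ∀ A → X A ≡ length (deduplicate ℚₚ._≟_ (ratios A))
  X≡ A = cong (length ∘ deduplicate ℚₚ._≟_) (concatMap-map≡cartesianProductWith ratio A A)
    where open import Function using (_∘_)

  X≤length² : ∀ A → X A ≤ length A * length A
  X≤length² A rewrite X≡ A = ≤-trans (List.length-deduplicate ℚₚ._≟_ (ratios A))
                                     (≤-reflexive (length-cartesianProductWith ratio A A))

  X-mono : ∀ {r B} → r ⊆ B → X r ≤ X B
  X-mono {r} {B} r⊆B rewrite X≡ r | X≡ B = ≤-trans (length-deduplicate-⊆-++ ℚₚ._≟_ (ratios r) (ratios B) [] into)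
                                                   (≤-reflexive (+-identityʳ _))
    where
    into : ratios r ⊆ ratios B ++ []
    into q∈ with ∈-cartesianProductWith⁻ ratio r r q∈
    ... | a , a′ , a∈r , a′∈r , refl = ∈-++⁺ˡ (∈-cartesianProductWith⁺ ratio (r⊆B a∈r) (r⊆B a′∈r))

  X-∷ : ∀ {r B b} → B ⊆ b ∷ r → X B ≤ X r + 2 * length B
  X-∷ {r} {B} {b} B⊆b∷r rewrite X≡ r | X≡ B = ≤-trans (length-deduplicate-⊆-++ ℚₚ._≟_ (ratios B) (ratios r) new into)
                                                      (≤-reflexive (cong (length (deduplicate ℚₚ._≟_ (ratios r)) +_) length-new))
    where
    new = map (ratio b) B ++ map (λ a → ratio a b) B
    length-new : length new ≡ 2 * length B
    length-new = trans (List.length-++ (map (ratio b) B))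
      (trans (cong₂ _+_ (List.length-map (ratio b) B) (List.length-map (λ a → ratio a b) B))
             (cong (length B +_) (sym (+-identityʳ (length B)))))
    into : ratios B ⊆ ratios r ++ new
    into q∈ with ∈-cartesianProductWith⁻ ratio B B q∈
    ... | a , a′ , a∈B , a′∈B , refl with B⊆b∷r a∈B | B⊆b∷r a′∈B
    ...   | here refl  | _           = ∈-++⁺ʳ (ratios r) (∈-++⁺ˡ (∈-map⁺ (ratio b) a′∈B))
    ...   | there _    | here refl   = ∈-++⁺ʳ (ratios r) (∈-++⁺ʳ (map (ratio b) B) (∈-map⁺ (λ a → ratio a b) a∈B))
    ...   | there a∈r  | there a′∈r = ∈-++⁺ˡ (∈-cartesianProductWith⁺ ratio a∈r a′∈r)

  X-Deletion : ∀ {r B} → Deletion r B → X r ≤ X B × X B ≤ X r + 2 * length B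
  X-Deletion d = X-mono ⊆-whole , X-∷ ⊆-removed-∷
    where open Deletion d

  X-DeletionBounded : ∀ j → DeletionBounded (λ A → X A ^ 1) (2 * suc j ^ 1) j
  X-DeletionBounded j {r} {B} |B|≡1+j d = ^-monoˡ-≤ 1 X-r≤X-B , (begin
      X B ^ 1               ≡⟨ *-identityʳ (X B) ⟩
      X B                   ≤⟨ X-B≤ ⟩
      X r + 2 * length B    ≡⟨ cong₂ (λ x l → x + 2 * l) (sym (*-identityʳ (X r))) (trans |B|≡1+j (sym (*-identityʳ (suc j)))) ⟩
      X r ^ 1 + 2 * suc j ^ 1  ∎)
    where
    open ≤-Reasoning
    X-r≤X-B = proj₁ (X-Deletion d)
    X-B≤ = proj₂ (X-Deletion d)

  X²-DeletionBounded : ∀ j → DeletionBounded (λ A → X A ^ 2) (8 * suc j ^ 3) j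
  X²-DeletionBounded j {r} {B} |B|≡1+j d = ^-monoˡ-≤ 2 (proj₁ (X-Deletion d)) , (begin
      X B ^ 2                            ≤⟨ ^-monoˡ-≤ 2 X-B≤ ⟩
      (x + E) ^ 2                        ≡⟨ expand x E ⟩
      x ^ 2 + (2 * x * E + E * E)        ≤⟨ +-monoʳ-≤ (x ^ 2) (+-monoˡ-≤ (E * E) (*-monoˡ-≤ E (*-monoʳ-≤ 2 x≤j²))) ⟩
      x ^ 2 + (2 * (j * j) * E + E * E)  ≤⟨ +-monoʳ-≤ (x ^ 2) (m≤m+n _ (4 * suc j * (j * j + 3 * j + 1))) ⟩
      x ^ 2 + (2 * (j * j) * E + E * E + 4 * suc j * (j * j + 3 * j + 1))
                                         ≡⟨ cong (x ^ 2 +_) (cube j) ⟩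
      x ^ 2 + 8 * suc j ^ 3              ∎)
    where
    open ≤-Reasoning
    x = X r
    E = 2 * suc j
    X-B≤ : X B ≤ x + E
    X-B≤ = subst (λ l → X B ≤ x + 2 * l) |B|≡1+j (proj₂ (X-Deletion d))
    x≤j² : x ≤ j * j
    x≤j² = subst (λ l → x ≤ l * l) (suc-injective (trans (Deletion.length-suc d) |B|≡1+j)) (X≤length² r)
    expand : ∀ a b → (a + b) * ((a + b) * 1) ≡ a * (a * 1) + (2 * a * b + b * b)
    expand = solve-∀
    cube : ∀ j → 2 * (j * j) * (2 * (1 + j)) + 2 * (1 + j) * (2 * (1 + j)) + 4 * (1 + j) * (j * j + 3 * j + 1)
                 ≡ 8 * ((1 + j) * ((1 + j) * ((1 + j) * 1)))
    cube = solve-∀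

module LevelMeans where
  open import Data.List using (List; []; _∷_; map; length)
  import Data.List.Properties as List
  open import Data.Nat as ℕ using (ℕ; suc; s≤s; z≤n; _∸_)
  open import Data.Nat.ListAction using (sum)
  import Data.Nat.Properties as ℕₚ
  open import Data.Product using (_,_)
  open import Data.Rational
  open import Data.Rational.Properties
  open import Relation.Binary.PropositionalEquality
  open import Defs using (ℕtoℚ; mean)
  open RationalArithmetic
  open SubsetLevels
  open BoundedIncrements using (IncrementBounded)

  mean-*-length : ∀ {A : Set} (g : A → ℕ) xs → mean (map g xs) * ℕtoℚ (length xs) ≡ ℕtoℚ (sum (map g xs))
  mean-*-length g []       = refl
  mean-*-length g (x ∷ xs) rewrite sym (List.length-map g xs) = /-*-ℕtoℚ (g x ℕ.+ sum (map g xs)) (length (map g xs))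

  ℕtoℚ-*-mean : ∀ {A : Set} a (g : A → ℕ) xs → ℕtoℚ (a ℕ.* length xs) * mean (map g xs) ≡ ℕtoℚ (a ℕ.* sum (map g xs))
  ℕtoℚ-*-mean a g xs = begin
      ℕtoℚ (a ℕ.* length xs) * mean (map g xs)       ≡⟨ cong (_* mean (map g xs)) (ℕtoℚ-homo-* a (length xs)) ⟩
      ℕtoℚ a * ℕtoℚ (length xs) * mean (map g xs)   ≡⟨ *-assoc (ℕtoℚ a) _ _ ⟩
      ℕtoℚ a * (ℕtoℚ (length xs) * mean (map g xs)) ≡⟨ cong (ℕtoℚ a *_) (trans (*-comm (ℕtoℚ (length xs)) (mean (map g xs))) (mean-*-length g xs)) ⟩
      ℕtoℚ a * ℕtoℚ (sum (map g xs))                ≡⟨ ℕtoℚ-homo-* a (sum (map g xs)) ⟨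
      ℕtoℚ (a ℕ.* sum (map g xs))                   ∎
    where open ≡-Reasoning

  module _ {A : Set} where

    levelMean : (List A → ℕ) → List A → ℕ → ℚ
    levelMean g L j = mean (map g (subsetsOfSize L j))

    ℕtoℚ-*-levelMean : ∀ (g : List A → ℕ) L i →
      ℕtoℚ (suc i ℕ.* levelCount L (suc i)) * levelMean g L i ≡ ℕtoℚ (deletionSum g L (suc i))
    ℕtoℚ-*-levelMean g L i = begin
        ℕtoℚ (suc i ℕ.* levelCount L (suc i)) * levelMean g L i
      ≡⟨ cong (λ a → ℕtoℚ a * levelMean g L i) (levelCount-doubleCount L i) ⟩
        ℕtoℚ ((length L ∸ i) ℕ.* levelCount L i) * levelMean g L i
      ≡⟨ ℕtoℚ-*-mean (length L ∸ i) g (subsetsOfSize L i) ⟩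
        ℕtoℚ ((length L ∸ i) ℕ.* levelSum g L i)
      ≡⟨ cong ℕtoℚ (deletionSum-doubleCount g L i) ⟨
        ℕtoℚ (deletionSum g L (suc i))
      ∎
      where open ≡-Reasoning

    -- Both bounds are compared after scaling by α = (i+1) N(i+1) = (|L| - i) N(i),
    -- which turns level means into the level sums of the double counting.
    levelMean-IncrementBounded : ∀ {g : List A → ℕ} {c e} → (∀ j → DeletionBounded g (c ℕ.* suc j ℕ.^ e) j) →
      ∀ L → IncrementBounded (levelMean g L) (length L) c e
    levelMean-IncrementBounded {g} {c} {e} bounded L i i<|L| =
      *-cancelˡ-≤-pos α {{positive 0<α}} (begin
        α * F i                         ≡⟨ ℕtoℚ-*-levelMean g L i ⟩
        ℕtoℚ (deletionSum g L (suc i))  ≤⟨ ℕtoℚ-mono-≤ (deletionSum-≤ (bounded i) L) ⟩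
        ℕtoℚ (suc i ℕ.* S₁)             ≡⟨ α*Fsuc ⟨
        α * F (suc i)                   ∎) ,
      *-cancelˡ-≤-pos α {{positive 0<α}} (begin
        α * F (suc i)                   ≡⟨ α*Fsuc ⟩
        ℕtoℚ (suc i ℕ.* S₁)             ≤⟨ ℕtoℚ-mono-≤ (deletionSum-≥ (bounded i) L) ⟩
        ℕtoℚ (deletionSum g L (suc i) ℕ.+ suc i ℕ.* (N₁ ℕ.* δ))
          ≡⟨ ℕtoℚ-homo-+ (deletionSum g L (suc i)) (suc i ℕ.* (N₁ ℕ.* δ)) ⟩
        ℕtoℚ (deletionSum g L (suc i)) + ℕtoℚ (suc i ℕ.* (N₁ ℕ.* δ))
          ≡⟨ cong₂ _+_ (sym (ℕtoℚ-*-levelMean g L i))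
                       (trans (cong ℕtoℚ (sym (ℕₚ.*-assoc (suc i) N₁ δ))) (ℕtoℚ-homo-* (suc i ℕ.* N₁) δ)) ⟩
        α * F i + α * ℕtoℚ δ            ≡⟨ *-distribˡ-+ α (F i) (ℕtoℚ δ) ⟨
        α * (F i + ℕtoℚ δ)              ∎)
      where
      open ≤-Reasoning
      F = levelMean g L
      δ = c ℕ.* suc i ℕ.^ e
      N₁ = levelCount L (suc i)
      S₁ = levelSum g L (suc i)
      α = ℕtoℚ (suc i ℕ.* N₁)
      0<α : 0ℚ < α
      0<α = ℕtoℚ-positive (ℕₚ.*-mono-≤ (s≤s (z≤n {i})) (levelCount-positive L (suc i) i<|L|))
      α*Fsuc : α * F (suc i) ≡ ℕtoℚ (suc i ℕ.* S₁)
      α*Fsuc = ℕtoℚ-*-mean (suc i) g (subsetsOfSize L (suc i))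

module BinomialMixture where
  open import Algebra.Bundles using (CommutativeRing)
  open import Data.List using (List; []; _∷_; map; _++_; length; upTo)
  import Data.List.Properties as List
  open import Data.List.Relation.Unary.All as All using (All; []; _∷_)
  import Data.List.Relation.Unary.All.Properties as All
  open import Data.Nat as ℕ using (ℕ; zero; suc; s≤s; z≤n; _∸_)
  open import Data.Nat.ListAction using (sum)
  import Data.Nat.Properties as ℕₚ
  import Data.Integer as ℤ
  open import Data.Rational
  open import Data.Rational.Properties
  open import Function using (_∘_)
  open import Relation.Binary.PropositionalEquality
  open import Relation.Nullary using (yes; no)
  open import Defs using (ℕtoℚ; _^ℚ_; sumℚ; subsets; range; Ebin; Ek)
  open import Tactic.RingSolver using (solve-∀)
  open RationalArithmetic
  open BinomialMean
  open SubsetLevels using (ofSize; ofSize-length; subsetsOfSize; levelSum)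
  open LevelMeans using (levelMean; mean-*-length)
  open ListSum (CommutativeRing.commutativeSemiring +-*-commutativeRing)

  sumTo : ℕ → (ℕ → ℚ) → ℚ
  sumTo zero    h = 0ℚ
  sumTo (suc M) h = h M + sumTo M h

  sumTo-+ : ∀ M (h₁ h₂ : ℕ → ℚ) → sumTo M (λ j → h₁ j + h₂ j) ≡ sumTo M h₁ + sumTo M h₂
  sumTo-+ zero    h₁ h₂ = refl
  sumTo-+ (suc M) h₁ h₂ rewrite sumTo-+ M h₁ h₂ = regroup (h₁ M) (h₂ M) (sumTo M h₁) (sumTo M h₂)
    where
    regroup : ∀ a b c d → a + b + (c + d) ≡ a + c + (b + d)
    regroup = solve-∀ ℚ-ring

  sumTo-cong : ∀ M {h₁ h₂ : ℕ → ℚ} → (∀ j → j ℕ.< M → h₁ j ≡ h₂ j) → sumTo M h₁ ≡ sumTo M h₂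
  sumTo-cong zero    eq = refl
  sumTo-cong (suc M) eq = cong₂ _+_ (eq M ℕₚ.≤-refl) (sumTo-cong M (λ j j<M → eq j (ℕₚ.m≤n⇒m≤1+n j<M)))

  sumTo-0 : ∀ M → sumTo M (λ _ → 0ℚ) ≡ 0ℚ
  sumTo-0 zero    = refl
  sumTo-0 (suc M) = trans (+-identityˡ _) (sumTo-0 M)

  sumℚ-ℕtoℚ : ∀ {A : Set} (g : A → ℕ) xs → sumℚ (map (ℕtoℚ ∘ g) xs) ≡ ℕtoℚ (sum (map g xs))
  sumℚ-ℕtoℚ g []       = refl
  sumℚ-ℕtoℚ g (x ∷ xs) = trans (cong (ℕtoℚ (g x) +_) (sumℚ-ℕtoℚ g xs)) (sym (ℕtoℚ-homo-+ (g x) (sum (map g xs))))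

  sumℚ-const : ∀ {A : Set} c (xs : List A) → sumℚ (map (λ _ → c) xs) ≡ c * ℕtoℚ (length xs)
  sumℚ-const c []       = sym (*-zeroʳ c)
  sumℚ-const c (x ∷ xs) = begin
      c + sumℚ (map (λ _ → c) xs)   ≡⟨ cong (c +_) (sumℚ-const c xs) ⟩
      c + c * ℕtoℚ (length xs)      ≡⟨ regroup c (ℕtoℚ (length xs)) ⟩
      c * (1ℚ + ℕtoℚ (length xs))   ≡⟨ cong (c *_) (ℕtoℚ-homo-+ 1 (length xs)) ⟨
      c * ℕtoℚ (suc (length xs))    ∎
    where
    open ≡-Reasoning
    regroup : ∀ c n → c + c * n ≡ c * (1ℚ + n)
    regroup = solve-∀ ℚ-ring

  module _ {A : Set} (φ : List A → ℚ) where

    sumTo-ofSize-[_] : ∀ x M → length x ℕ.< M → sumTo M (λ j → sumℚ (map φ (ofSize j (x ∷ [])))) ≡ φ x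
    sumTo-ofSize-[ x ] (suc M) |x|<1+M with length x ℕ.≟ M
    ... | yes |x|≡M = begin
        sumℚ (map φ (ofSize M (x ∷ []))) + sumTo M (λ j → sumℚ (map φ (ofSize j (x ∷ []))))
      ≡⟨ cong₂ _+_ (cong (sumℚ ∘ map φ) (List.filter-accept (λ B → length B ℕ.≟ M) {x} {[]} |x|≡M))
                   (trans (sumTo-cong M (λ j j<M → cong (sumℚ ∘ map φ) (List.filter-reject (λ B → length B ℕ.≟ j) {x} {[]}
                                                     (λ |x|≡j → ℕₚ.<⇒≢ j<M (trans (sym |x|≡j) |x|≡M)))))
                          (sumTo-0 M)) ⟩
        φ x + 0ℚ + 0ℚ
      ≡⟨ trans (+-identityʳ (φ x + 0ℚ)) (+-identityʳ (φ x)) ⟩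
        φ x
      ∎
      where open ≡-Reasoning
    ... | no |x|≢M = trans (cong (_+ rest) (cong (sumℚ ∘ map φ) (List.filter-reject (λ B → length B ℕ.≟ M) {x} {[]} |x|≢M)))
                           (trans (+-identityˡ rest) (sumTo-ofSize-[ x ] M (ℕₚ.≤∧≢⇒< (ℕₚ.≤-pred |x|<1+M) |x|≢M)))
      where rest = sumTo M (λ j → sumℚ (map φ (ofSize j (x ∷ []))))

    sum-byLevel : ∀ M xs → All (λ B → length B ℕ.< M) xs → sumℚ (map φ xs) ≡ sumTo M (λ j → sumℚ (map φ (ofSize j xs)))
    sum-byLevel M []       []                = sym (sumTo-0 M)
    sum-byLevel M (x ∷ xs) (|x|<M ∷ lengths) = sym (begin
        sumTo M (λ j → sumℚ (map φ (ofSize j (x ∷ xs))))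
      ≡⟨ sumTo-cong M (λ j _ → trans (cong (sumℚ ∘ map φ) (List.filter-++ (λ B → length B ℕ.≟ j) (x ∷ []) xs))
                                      (sumOf-++ φ (ofSize j (x ∷ [])) (ofSize j xs))) ⟩
        sumTo M (λ j → sumℚ (map φ (ofSize j (x ∷ []))) + sumℚ (map φ (ofSize j xs)))
      ≡⟨ sumTo-+ M _ _ ⟩
        sumTo M (λ j → sumℚ (map φ (ofSize j (x ∷ [])))) + sumTo M (λ j → sumℚ (map φ (ofSize j xs)))
      ≡⟨ cong₂ _+_ (sumTo-ofSize-[ x ] M |x|<M) (sym (sum-byLevel M xs lengths)) ⟩
        φ x + sumℚ (map φ xs)
      ∎)
      where open ≡-Reasoning

  subsets-length-≤ : ∀ {A : Set} (L : List A) → All (λ B → length B ℕ.≤ length L) (subsets L)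
  subsets-length-≤ []      = z≤n ∷ []
  subsets-length-≤ (x ∷ L) =
    All.++⁺ (All.map⁺ (All.map s≤s (subsets-length-≤ L))) (All.map ℕₚ.m≤n⇒m≤1+n (subsets-length-≤ L))

  -- grouping the subsets B of L by whether they contain the head of L is the recursion of binMean
  binMean-subsets : ∀ p (h : ℕ → ℚ) {A : Set} (L : List A) →
    sumℚ (map (λ B → p ^ℚ length B * (1ℚ - p) ^ℚ (length L ∸ length B) * h (length B)) (subsets L))
      ≡ binMean p (length L) h
  binMean-subsets p h []      = regroup (h 0)
    where
    regroup : ∀ a → 1ℚ * 1ℚ * a + 0ℚ ≡ a
    regroup = solve-∀ ℚ-ring
  binMean-subsets p h (x ∷ L) = begin
      sumOf w (map (x ∷_) (subsets L) ++ subsets L)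
    ≡⟨ sumOf-++ w (map (x ∷_) (subsets L)) (subsets L) ⟩
      sumOf w (map (x ∷_) (subsets L)) + sumOf w (subsets L)
    ≡⟨ cong₂ _+_
         (trans (sumOf-map w (x ∷_) (subsets L)) (trans
           (sumOf-cong (subsets L) (All.tabulate (λ {B} _ → shift-p p (p ^ℚ length B) (q ^ℚ (length L ∸ length B)) (h (suc (length B))))))
           (sumOf-*ˡ p _ (subsets L))))
         (trans
           (sumOf-cong (subsets L) (All.map (λ {B} |B|≤|L| → trans (cong (λ e → p ^ℚ length B * q ^ℚ e * h (length B)) (ℕₚ.+-∸-assoc 1 |B|≤|L|))
                                                        (shift-q q (p ^ℚ length B) (q ^ℚ (length L ∸ length B)) (h (length B))))
                                (subsets-length-≤ L)))
           (sumOf-*ˡ q _ (subsets L))) ⟩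
      p * sumOf (λ B → p ^ℚ length B * q ^ℚ (length L ∸ length B) * h (suc (length B))) (subsets L)
        + q * sumOf (λ B → p ^ℚ length B * q ^ℚ (length L ∸ length B) * h (length B)) (subsets L)
    ≡⟨ cong₂ (λ a b → p * a + q * b) (binMean-subsets p (h ∘ suc) L) (binMean-subsets p h L) ⟩
      p * binMean p (length L) (h ∘ suc) + q * binMean p (length L) h
    ∎
    where
    open ≡-Reasoning
    q = 1ℚ - p
    w : List _ → ℚ
    w B = p ^ℚ length B * q ^ℚ (suc (length L) ∸ length B) * h (length B)
    shift-p : ∀ p a b c → p * a * b * c ≡ p * (a * b * c)
    shift-p = solve-∀ ℚ-ring
    shift-q : ∀ q a b c → a * (q * b) * c ≡ q * (a * b * c)
    shift-q = solve-∀ ℚ-ring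

  length-range : ∀ n → length (range n) ≡ n
  length-range n = trans (List.length-map suc (upTo n)) (List.length-upTo n)

  module _ (w : ℕ → ℚ) (g : List ℕ → ℕ) (L : List ℕ) (j : ℕ) where

    sum-weighted-levelSum : sumℚ (map (λ A → w (length A) * ℕtoℚ (g A)) (subsetsOfSize L j)) ≡ w j * ℕtoℚ (levelSum g L j)
    sum-weighted-levelSum = begin
        sumℚ (map (λ A → w (length A) * ℕtoℚ (g A)) (subsetsOfSize L j))
      ≡⟨ sumOf-cong (subsetsOfSize L j) (All.map (λ {A} |A|≡j → cong (λ i → w i * ℕtoℚ (g A)) |A|≡j) (ofSize-length j (subsets L))) ⟩
        sumℚ (map (λ A → w j * ℕtoℚ (g A)) (subsetsOfSize L j))
      ≡⟨ sumOf-*ˡ (w j) (ℕtoℚ ∘ g) (subsetsOfSize L j) ⟩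
        w j * sumℚ (map (ℕtoℚ ∘ g) (subsetsOfSize L j))
      ≡⟨ cong (w j *_) (sumℚ-ℕtoℚ g (subsetsOfSize L j)) ⟩
        w j * ℕtoℚ (levelSum g L j)
      ∎
      where open ≡-Reasoning

    sum-weighted-levelMean : sumℚ (map (λ A → w (length A) * levelMean g L (length A)) (subsetsOfSize L j)) ≡ w j * ℕtoℚ (levelSum g L j)
    sum-weighted-levelMean = begin
        sumℚ (map (λ A → w (length A) * F (length A)) (subsetsOfSize L j))
      ≡⟨ sumOf-cong (subsetsOfSize L j) (All.map (λ |A|≡j → cong (λ i → w i * F i) |A|≡j) (ofSize-length j (subsets L))) ⟩
        sumℚ (map (λ _ → w j * F j) (subsetsOfSize L j))
      ≡⟨ sumℚ-const (w j * F j) (subsetsOfSize L j) ⟩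
        w j * F j * ℕtoℚ (length (subsetsOfSize L j))
      ≡⟨ trans (*-assoc (w j) (F j) _) (cong (w j *_) (mean-*-length g (subsetsOfSize L j))) ⟩
        w j * ℕtoℚ (levelSum g L j)
      ∎
      where
      open ≡-Reasoning
      F = levelMean g L

  -- conditioned on |A| = j, the binomial model is the uniform model on j-subsets
  Ebin≡binMean-Ek : ∀ (g : List ℕ → ℕ) n k →
    Ebin (suc n) k g ≡ binMean ((ℤ.+ k) / suc n) (suc n) (λ j → Ek (suc n) j g)
  Ebin≡binMean-Ek g n k = begin
      sumℚ (map (λ A → w (length A) * ℕtoℚ (g A)) (subsets L))
    ≡⟨ sum-byLevel _ (suc N) (subsets L) lengths ⟩
      sumTo (suc N) (λ j → sumℚ (map (λ A → w (length A) * ℕtoℚ (g A)) (subsetsOfSize L j)))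
    ≡⟨ sumTo-cong (suc N) (λ j _ → trans (sum-weighted-levelSum w g L j) (sym (sum-weighted-levelMean w g L j))) ⟩
      sumTo (suc N) (λ j → sumℚ (map (λ A → w (length A) * F (length A)) (subsetsOfSize L j)))
    ≡⟨ sum-byLevel _ (suc N) (subsets L) lengths ⟨
      sumℚ (map (λ A → w (length A) * F (length A)) (subsets L))
    ≡⟨ subst (λ m → sumℚ (map (λ A → p ^ℚ length A * (1ℚ - p) ^ℚ (m ∸ length A) * F (length A)) (subsets L)) ≡ binMean p m F)
             (length-range N) (binMean-subsets p F L) ⟩
      binMean p N F
    ∎
    where
    open ≡-Reasoning
    N = suc n
    L = range N
    p = (ℤ.+ k) / N
    w : ℕ → ℚ
    w j = p ^ℚ j * (1ℚ - p) ^ℚ (N ∸ j)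
    F : ℕ → ℚ
    F j = Ek N j g
    lengths : All (λ A → length A ℕ.< suc N) (subsets L)
    lengths = All.map (λ {A} |A|≤ → s≤s (ℕₚ.≤-trans |A|≤ (ℕₚ.≤-reflexive (length-range N)))) (subsets-length-≤ L)

module UniformVersusBinomial where
  open import Data.List using (List)
  open import Data.Nat as ℕ using (ℕ; zero; suc; s≤s; z≤n)
  import Data.Nat.Properties as ℕₚ
  import Data.Integer as ℤ
  open import Data.Rational
  open import Data.Rational.Properties
  open import Relation.Binary.PropositionalEquality
  open import Relation.Nullary using (contradiction)
  open import Defs using (ℕtoℚ; Ek; Ebin; range)
  open RationalArithmetic
  open BinomialMean using (binMean)
  open BoundedIncrements using (IncrementBounded; binMean-gap-≤)
  open SubsetLevels using (DeletionBounded)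
  open LevelMeans using (levelMean-IncrementBounded)
  open BinomialMixture using (Ebin≡binMean-Ek; length-range)

  module _ (n k : ℕ) where

    private
      p = (ℤ.+ k) / suc n

    0≤k/[1+n] : 0ℚ ≤ p
    0≤k/[1+n] = nonNegative⁻¹ p {{normalize-nonNeg k (suc n)}}

    [1+n]*k/[1+n]≡k : ℕtoℚ (suc n) * p ≡ ℕtoℚ k
    [1+n]*k/[1+n]≡k = trans (*-comm (ℕtoℚ (suc n)) p) (/-*-ℕtoℚ k n)

    0≤1-k/[1+n] : k ℕ.≤ suc n → 0ℚ ≤ 1ℚ - p
    0≤1-k/[1+n] k≤n = p≤q⇒0≤q-p (*-cancelˡ-≤-pos (ℕtoℚ (suc n)) {{positive (ℕtoℚ-positive {suc n} (s≤s z≤n))}} (begin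
        ℕtoℚ (suc n) * p    ≡⟨ [1+n]*k/[1+n]≡k ⟩
        ℕtoℚ k              ≤⟨ ℕtoℚ-mono-≤ k≤n ⟩
        ℕtoℚ (suc n)        ≡⟨ *-identityʳ (ℕtoℚ (suc n)) ⟨
        ℕtoℚ (suc n) * 1ℚ   ∎))
      where open ≤-Reasoning

  Ek-Ebin-gap-≤ : ∀ (g : List ℕ → ℕ) c e → (∀ j → DeletionBounded g (c ℕ.* suc j ℕ.^ e) j) →
    ∀ n k → 1 ℕ.≤ k → k ℕ.≤ n →
    (Ek n k g - Ebin n k g) * (Ek n k g - Ebin n k g) * ℕtoℚ k
      ≤ ℕtoℚ (c ℕ.* c ℕ.* (2 ℕ.+ (e ℕ.+ e)) ℕ.^ (e ℕ.+ e) ℕ.* k ℕ.^ (e ℕ.+ e ℕ.+ 2))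
  Ek-Ebin-gap-≤ g c e bounded zero    k 1≤k k≤0 = contradiction (ℕₚ.≤-trans 1≤k k≤0) λ ()
  Ek-Ebin-gap-≤ g c e bounded (suc n) k 1≤k k≤n = begin
      (F k - Ebin (suc n) k g) * (F k - Ebin (suc n) k g) * ℕtoℚ k
    ≡⟨ cong (λ E → (F k - E) * (F k - E) * ℕtoℚ k) (Ebin≡binMean-Ek g n k) ⟩
      (F k - binMean p (suc n) F) * (F k - binMean p (suc n) F) * ℕtoℚ k
    ≤⟨ binMean-gap-≤ {F} {suc n} {c} {e} {k} {p} inc (0≤k/[1+n] n k) (0≤1-k/[1+n] n k k≤n) ([1+n]*k/[1+n]≡k n k) 1≤k k≤n ⟩
      ℕtoℚ (c ℕ.* c ℕ.* (2 ℕ.+ (e ℕ.+ e)) ℕ.^ (e ℕ.+ e) ℕ.* k ℕ.^ (e ℕ.+ e ℕ.+ 2))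
    ∎
    where
    open ≤-Reasoning
    p = (ℤ.+ k) / suc n
    F : ℕ → ℚ
    F j = Ek (suc n) j g
    inc : IncrementBounded F (suc n) c e
    inc = subst (λ m → IncrementBounded F m c e) (length-range (suc n)) (levelMean-IncrementBounded {g = g} {c} {e} bounded (range (suc n)))

open import Defs
open import Data.Nat using (ℕ; _≤_; _^_) renaming (_*_ to _*ℕ_)
open import Data.Product using (∃; _,_)
open import Data.Sum using (_⊎_; inj₁; inj₂)
open import Relation.Binary.PropositionalEquality using (_≡_; refl)
open import Data.Rational using (_*_; _-_) renaming (_≤_ to _≤ℚ_)
open RatioSet using (X-DeletionBounded; X²-DeletionBounded)
open UniformVersusBinomial using (Ek-Ebin-gap-≤)

proposition3p1 : (s : ℕ) → s ≡ 1 ⊎ s ≡ 2 →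
    ∃ λ (C : ℕ) → (n k : ℕ) → 1 ≤ k → k ≤ n →
      ((Ek n k (λ A → X A ^ s) - Ebin n k (λ A → X A ^ s))
        * (Ek n k (λ A → X A ^ s) - Ebin n k (λ A → X A ^ s)))
        * ℕtoℚ k
      ≤ℚ ℕtoℚ (C *ℕ C *ℕ k ^ (4 *ℕ s))
-- C * C = c * c * (2 + 2e) ^ (2e) and k ^ (2e + 2) = k ^ (4s) hold by evaluation.
proposition3p1 .1 (inj₁ refl) = 8 , Ek-Ebin-gap-≤ (λ A → X A ^ 1) 2 1 X-DeletionBounded
proposition3p1 .2 (inj₂ refl) = 4096 , Ek-Ebin-gap-≤ (λ A → X A ^ 2) 8 3 X²-DeletionBounded
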